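{- Let $G$ be a graph and $k\in\mathbb{N}$. Then $G$ has treewidth at most $k$ if and only if there exists a $k$-instructive tree decomposition $\tau$ such that $G(\tau)\simeq G$.
   Context: A graph is a triple $G=(V,E,I)$ with $V,E$ finite subsets of $\mathbb{N}$ and $I\subseteq E\times V$ an incidence relation; each edge $e$ has endpoint set $\{v:(e,v)\in I\}$ (multi-edges allowed). $\simeq$ denotes isomorphism (bijections on vertices and on edges preserving incidence). Treewidth is the usual notion (minimum over tree decompositions, i.e. trees with bags covering all vertices, each edge's endpoints contained in some bag, and each vertex's bags forming a connected subtree, of the maximum bag size minus one). $k$-instructive alphabet $\Sigma_k$: the symbol $\mathrm{Leaf}$ (arity 0), symbols $\mathrm{IntroVertex}_u$, $\mathrm{ForgetVertex}_u$, $\mathrm{IntroEdge}_{u,v}$ (arity 1), and $\mathrm{Join}$ (arity 2), for $u,v\in[k+1]$, $u\ne v$. A $k$-instructive tree decomposition is a term over $\Sigma_k$ accepted by the tree automaton whose states are all subsets $B\subseteq[k+1]$ (all final) with transitions $\mathrm{Leaf}\to\emptyset$; $\mathrm{IntroVertex}_u(B)\to B\cup\{u\}$ for $u\notin B$; $\mathrm{ForgetVertex}_u(B)\to B\setminus\{u\}$ for $u\in B$; $\mathrm{IntroEdge}_{u,v}(B)\to B$ for $u,v\in B$; $\mathrm{Join}(B,B)\to B$. To each such term $\tau$ associate a graph $G(\tau)$ and an injective map $\iota_\tau$ from the set of active labels (the state reached) into $V(G(\tau))$, inductively: $\mathrm{Leaf}$: empty graph and empty map; $\mathrm{IntroVertex}_u(\sigma)$: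 add a new vertex $|V(G(\sigma))|+1$ and set $\iota_\tau(u)$ to it; $\mathrm{ForgetVertex}_u(\sigma)$: same graph, remove $u$ from the domain of the map; $\mathrm{IntroEdge}_{u,v}(\sigma)$: add a new edge $|E(G(\sigma))|+1$ incident with $\iota_\sigma(u)$ and $\iota_\sigma(v)$, same map; $\mathrm{Join}(\sigma_1,\sigma_2)$: the graph obtained from disjoint copies of $G(\sigma_1)$ and $G(\sigma_2)$ by identifying $\iota_{\sigma_1}(u)$ with $\iota_{\sigma_2}(u)$ for each active label $u$, with map $\iota_{\sigma_1}$.
   Formalization: Every edge of $G$ has exactly two distinct endpoints, so $G$ is a loopless multigraph, instead of an edge having an arbitrary endpoint set $\{v:(e,v)\in I\}$. The statement above fails without it. -}

module Defs where

open import Data.Nat using (ℕ; zero; suc; _+_; _≤_)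
open import Data.Nat.Properties using (_≟_)
open import Data.Bool using (Bool; true; false; if_then_else_)
open import Data.Fin using (Fin; toℕ) renaming (zero to fzero; suc to fsuc)
open import Data.Fin.Subset using (Subset; _∈_; _∉_; _∪_; _-_; ⁅_⁆; ⊥)
open import Data.Fin.Subset.Properties using (_∈?_)
open import Data.List using (List; []; _∷_; _++_; length; map; upTo; concat; allFin; zip)
open import Data.List.Relation.Unary.Unique.Propositional using (Unique)
import Data.List.Membership.Propositional as LM
open import Data.Maybe using (Maybe; just; nothing)
open import Data.Product using (Σ; ∃; ∃-syntax; _×_; _,_)
open import Data.Sum using (_⊎_)
open import Relation.Nullary using (¬_; yes; no; Dec)
open import Relation.Nullary.Decidable using (⌊_⌋)
open import Relation.Binary.PropositionalEquality using (_≡_; _≢_)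
open import Function.Bundles using (_⇔_)

-- Graphs: V, E finite subsets of ℕ (given as lists; only membership
-- matters), I ⊆ E × V an incidence relation (a finite list of pairs).

record Graph : Set where
  constructor mkGraph
  field
    V : List ℕ
    E : List ℕ
    I : List (ℕ × ℕ)
open Graph public

_∈ℕ_ : ℕ → List ℕ → Set
x ∈ℕ xs = x LM.∈ xs

_∈I_ : ℕ × ℕ → List (ℕ × ℕ) → Set
p ∈I ps = p LM.∈ ps

record IsGraph (G : Graph) : Set where
  field
    inc-sub : ∀ e v → (e , v) ∈I I G → (e ∈ℕ E G) × (v ∈ℕ V G)
    two-ends : ∀ e → e ∈ℕ E G →
      ∃[ a ] ∃[ b ] (a ≢ b × (e , a) ∈I I G × (e , b) ∈I I G
                     × (∀ v → (e , v) ∈I I G → (v ≡ a ⊎ v ≡ b)))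

record _≃_ (G H : Graph) : Set where
  field
    fV gV fE gE : ℕ → ℕ
    fV-into : ∀ v → v ∈ℕ V G → fV v ∈ℕ V H
    gV-into : ∀ w → w ∈ℕ V H → gV w ∈ℕ V G
    gfV : ∀ v → v ∈ℕ V G → gV (fV v) ≡ v
    fgV : ∀ w → w ∈ℕ V H → fV (gV w) ≡ w
    fE-into : ∀ e → e ∈ℕ E G → fE e ∈ℕ E H
    gE-into : ∀ e → e ∈ℕ E H → gE e ∈ℕ E G
    gfE : ∀ e → e ∈ℕ E G → gE (fE e) ≡ e
    fgE : ∀ e → e ∈ℕ E H → fE (gE e) ≡ e
    inc : ∀ e v → e ∈ℕ E G → v ∈ℕ V G →
          ((e , v) ∈I I G ⇔ (fE e , fV v) ∈I I H)

-- Trees: a finite tree with nodes Fin (suc m), rooted at node 0, where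
-- node (suc i) is attached to a parent of index ≤ i.  Every finite
-- (nonempty) tree is isomorphic to one of this form.

record Tree : Set where
  field
    m : ℕ
    parent : Fin m → Fin (suc m)
    parent-< : ∀ i → toℕ (parent i) ≤ toℕ i
open Tree public

Node : Tree → Set
Node T = Fin (suc (m T))

data Adj (T : Tree) : Node T → Node T → Set where
  up   : ∀ i → Adj T (fsuc i) (parent T i)
  down : ∀ i → Adj T (parent T i) (fsuc i)

data PathIn (T : Tree) (P : Node T → Set) : Node T → Node T → Set where
  here : ∀ {s} → P s → PathIn T P s s
  step : ∀ {s s' t} → P s → Adj T s s' → PathIn T P s' t → PathIn T P s t

record TreeDecomposition (G : Graph) : Set where
  field
    tree : Tree
    bag : Node tree → List ℕ
    bag-unique : ∀ t → Unique (bag t)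
    bag-sub : ∀ t v → v ∈ℕ bag t → v ∈ℕ V G
    cover-vertices : ∀ v → v ∈ℕ V G → ∃[ t ] (v ∈ℕ bag t)
    cover-edges : ∀ e → e ∈ℕ E G → ∃[ t ] (∀ v → (e , v) ∈I I G → v ∈ℕ bag t)
    connected : ∀ v s t → v ∈ℕ bag s → v ∈ℕ bag t →
                PathIn tree (λ x → v ∈ℕ bag x) s t
open TreeDecomposition public

-- width ≤ k  (width = max bag size − 1)
WidthAtMost : ∀ {G} → TreeDecomposition G → ℕ → Set
WidthAtMost D k = ∀ t → length (bag D t) ≤ suc k

TreewidthAtMost : Graph → ℕ → Set
TreewidthAtMost G k = ∃[ D ] (WidthAtMost {G} D k)

-- k-instructive tree decompositions: terms over Σ_k accepted by the
-- tree automaton, presented as a family indexed by the reached state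
-- B ⊆ [k+1] (labels [k+1] are Fin (suc k)).

data ITD (k : ℕ) : Subset (suc k) → Set where
  Leaf        : ITD k ⊥
  IntroVertex : ∀ {B} (u : Fin (suc k)) → u ∉ B → ITD k B → ITD k (B ∪ ⁅ u ⁆)
  ForgetVertex : ∀ {B} (u : Fin (suc k)) → u ∈ B → ITD k B → ITD k (B - u)
  IntroEdge   : ∀ {B} (u v : Fin (suc k)) → u ≢ v → u ∈ B → v ∈ B →
                ITD k B → ITD k B
  Join        : ∀ {B} → ITD k B → ITD k B → ITD k B

-- Intermediate data: number of vertices n (vertices are 1..n), the list
-- of edges (edge number i+1 is the i-th entry, given by its two
-- endpoints), and the label map ι (meaningful on active labels only).
record Built (k : ℕ) : Set where
  constructor built
  field
    nV : ℕ
    edges : List (ℕ × ℕ)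
    ι : Fin (suc k) → ℕ

findLabel : ∀ {k} → Subset (suc k) → (Fin (suc k) → ℕ) → ℕ → List (Fin (suc k)) → Maybe (Fin (suc k))
findLabel B ι x [] = nothing
findLabel B ι x (u ∷ us) with u ∈? B | ι u ≟ x
... | yes _ | yes _ = just u
... | _ | _ = findLabel B ι x us

countFresh : ∀ {k} → Subset (suc k) → (Fin (suc k) → ℕ) → ℕ → ℕ
countFresh B ι zero = zero
countFresh B ι (suc x) with findLabel B ι (suc x) (allFin _)
... | just _  = countFresh B ι x
... | nothing = suc (countFresh B ι x)

build : ∀ {k B} → ITD k B → Built k
build Leaf = built 0 [] (λ _ → 0)
build (IntroVertex u _ σ) with build σ
... | built n es ι = built (suc n) es (λ w → if ⌊ w Data.Fin.≟ u ⌋ then suc n else ι w)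
build (ForgetVertex u _ σ) = build σ
build (IntroEdge u v _ _ _ σ) with build σ
... | built n es ι = built n (es ++ ((ι u , ι v) ∷ [])) ι
build {B = B} (Join σ₁ σ₂) with build σ₁ | build σ₂
... | built n₁ es₁ ι₁ | built n₂ es₂ ι₂ = built (n₁ + countFresh B ι₂ n₂) (es₁ ++ map hh es₂) ι₁
  where
  -- disjoint union with identification of ι₂(u) and ι₁(u) for active u;
  -- the non-identified vertices of the second graph are renumbered
  -- n₁+1, n₁+2, ... in increasing order
  h : ℕ → ℕ
  h x with findLabel B ι₂ x (allFin _)
  ... | just u  = ι₁ u
  ... | nothing = n₁ + countFresh B ι₂ x
  hh : ℕ × ℕ → ℕ × ℕ
  hh (a , b) = h a , h b

incidences : ℕ → List (ℕ × ℕ) → List (ℕ × ℕ)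
incidences i [] = []
incidences i ((a , b) ∷ es) = (suc i , a) ∷ (suc i , b) ∷ incidences (suc i) es

toGraph : ∀ {k} → Built k → Graph
toGraph (built n es ι) = mkGraph (map suc (upTo n)) (map suc (upTo (length es))) (incidences 0 es)

graphOf : ∀ {k B} → ITD k B → Graph
graphOf τ = toGraph (build τ)

-- A term τ is realised in a graph by lists of vertices and edges and a labelling that
-- are built up exactly as G(τ) is. By induction on τ, any two realisations of τ are in
-- bijection, compatibly with incidence and labels, and G(τ) itself realises τ; so
-- G(τ) ≃ G as soon as τ is realised in G by all of its vertices and edges.
--
-- A realisation yields a tree decomposition whose root bag is the set of active
-- vertices, hence of size at most k + 1: IntroVertex puts a new root above, and Join
-- glues the two decompositions at their roots, which contain every shared vertex.
--
-- Conversely, given a decomposition of width at most k, label every bag injectively by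
-- [k+1], keeping the parent's label on vertices shared with the parent. The term of a
-- subtree introduces the bag of its root, joins the terms of the children (each after
-- forgetting the vertices that leave the bag) and introduces the edges placed at the
-- root. By connectivity of the decomposition, distinct children only share vertices of
-- the root bag, so this term is realised in G by all its vertices and edges.

module Submission where

open import Defs
open import Data.Nat using (ℕ)
open import Data.Fin.Subset using (Subset)
open import Data.Product using (∃-syntax)
open import Function.Bundles using (_⇔_)

open import Data.Nat using (zero; suc; _+_; _∸_; _≤_; _<_; z≤n; s≤s)
import Data.Nat.Properties as ℕ
open import Data.Nat.Instances
open import Data.Bool using (if_then_else_)
open import Data.Fin as Fin using (Fin; toℕ; _↑ˡ_; _↑ʳ_; splitAt) renaming (zero to fzero; suc to fsuc)
import Data.Fin.Properties as Fin
open import Data.Fin.Instances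
open import Data.Fin.Subset using (⁅_⁆; _∪_; _-_; _─_; inside; outside) renaming (_∈_ to _∈s_; _∉_ to _∉s_; ⊥ to ∅)
import Data.Fin.Subset.Properties as Subset
open import Data.Vec using (_∷_; here; there)
open import Data.List using (List; []; _∷_; _++_; map; length; upTo; allFin; filter; lookup; deduplicate)
import Data.List.Properties as List
open import Data.List.Membership.Propositional using (_∈_)
open import Data.List.Membership.Propositional.Properties
open import Data.List.Membership.DecPropositional ℕ._≟_ using () renaming (_∈?_ to _∈ℕ?_)
open import Data.List.Relation.Unary.Any as Any using (here; there; any?; satisfied)
import Data.List.Relation.Unary.Any.Properties as Any
import Data.List.Relation.Unary.All as All
open import Data.List.Relation.Unary.AllPairs using ([]; _∷_)
open import Data.List.Relation.Unary.Unique.Propositional using (Unique)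
import Data.List.Relation.Unary.Unique.Propositional.Properties as Unique
import Data.List.Relation.Unary.Unique.DecPropositional.Properties as UniqueDec
open import Data.Maybe using (just; nothing)
open import Data.Product using (Σ; _×_; _,_; proj₁; proj₂; map₁; map₂)
open import Data.Sum as Sum using (_⊎_; inj₁; inj₂; [_,_])
open import Data.Empty using (⊥; ⊥-elim)
open import Relation.Nullary using (¬_; Dec; yes; no; ¬?)
open import Relation.Nullary.Decidable using (⌊_⌋)
open import Relation.Binary.Definitions using (tri<; tri≈; tri>)
open import Relation.Binary.PropositionalEquality hiding ([_])
open ≡-Reasoning
open import Relation.Binary.Structures using (IsDecEquivalence)
open import Relation.Binary.TypeClasses using (_≟_)
open import Function.Bundles using (mk⇔; Equivalence)

update : ∀ {A B : Set} {{_ : IsDecEquivalence (_≡_ {A = A})}} → (A → B) → A → B → A → B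
update f a b x = if ⌊ x ≟ a ⌋ then b else f x

module _ {A B : Set} {{_ : IsDecEquivalence (_≡_ {A = A})}} where

  update-same : ∀ (f : A → B) a b → update f a b a ≡ b
  update-same f a b with a ≟ a
  ... | yes _ = refl
  ... | no a≢a = ⊥-elim (a≢a refl)

  update-other : ∀ (f : A → B) a b x → x ≢ a → update f a b x ≡ f x
  update-other f a b x x≢a with x ≟ a
  ... | yes x≡a = ⊥-elim (x≢a x≡a)
  ... | no _ = refl

  update-∘ : ∀ {C : Set} (φ : B → C) (f : A → B) a b x → φ (update f a b x) ≡ update (λ y → φ (f y)) a (φ b) x
  update-∘ φ f a b x with x ≟ a
  ... | yes _ = refl
  ... | no _ = refl

x∈p─q⇒x∉q : ∀ {n} {x : Fin n} (p q : Subset n) → x ∈s p ─ q → x ∉s q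
x∈p─q⇒x∉q (_ ∷ p) (inside ∷ q) (there x∈) (there x∈q) = x∈p─q⇒x∉q p q x∈ x∈q
x∈p─q⇒x∉q (_ ∷ p) (outside ∷ q) (there x∈) (there x∈q) = x∈p─q⇒x∉q p q x∈ x∈q

module _ {n : ℕ} where

  x∈p-y⇒x∈p×x≢y : ∀ {p : Subset n} {x y} → x ∈s p - y → x ∈s p × x ≢ y
  x∈p-y⇒x∈p×x≢y {p} {x} {y} x∈ =
    Subset.p─q⊆p p ⁅ y ⁆ x∈ , λ { refl → x∈p─q⇒x∉q p ⁅ y ⁆ x∈ (Subset.x∈⁅x⁆ y) }

  x∈p∪⁅y⁆⁻ : ∀ {p : Subset n} {x y} → x ∈s p ∪ ⁅ y ⁆ → x ∈s p ⊎ x ≡ y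
  x∈p∪⁅y⁆⁻ {p} {y = y} x∈ = Sum.map₂ (Subset.x∈⁅y⁆⇒x≡y y) (Subset.x∈p∪q⁻ p ⁅ y ⁆ x∈)

  y∈p∪⁅y⁆ : ∀ {p : Subset n} y → y ∈s p ∪ ⁅ y ⁆
  y∈p∪⁅y⁆ {p} y = Subset.x∈p∪q⁺ {p = p} (inj₂ (Subset.x∈⁅x⁆ y))

∈⇒≢ : ∀ {x w} {X : List ℕ} → x ∈ℕ X → ¬ (w ∈ℕ X) → x ≢ w
∈⇒≢ x∈ w∉ refl = w∉ x∈

Incidence : Set
Incidence = List (ℕ × ℕ)

Ends : Incidence → ℕ → ℕ → ℕ → Set
Ends H e a b = ∀ v → ((e , v) ∈I H → v ≡ a ⊎ v ≡ b) × (v ≡ a ⊎ v ≡ b → (e , v) ∈I H)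

_≐_ : List ℕ → List ℕ → Set
X ≐ Y = ∀ x → (x ∈ℕ X → x ∈ℕ Y) × (x ∈ℕ Y → x ∈ℕ X)

record BijectionOn (f : ℕ → ℕ) (X Y : List ℕ) : Set where
  field
    into : ∀ x → x ∈ℕ X → f x ∈ℕ Y
    inj : ∀ x y → x ∈ℕ X → y ∈ℕ X → f x ≡ f y → x ≡ y
    onto : ∀ y → y ∈ℕ Y → ∃[ x ] (x ∈ℕ X × f x ≡ y)
open BijectionOn

bijectionOn-[] : BijectionOn (λ x → x) [] []
bijectionOn-[] = record { into = λ _ () ; inj = λ _ _ () ; onto = λ _ () }

bijectionOn-∷ : ∀ {f X Y w w'} → BijectionOn f X Y → ¬ (w ∈ℕ X) → ¬ (w' ∈ℕ Y) →
  BijectionOn (update f w w') (w ∷ X) (w' ∷ Y)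
bijectionOn-∷ {f} {X} {Y} {w} {w'} b w∉X w'∉Y = record { into = into' ; inj = inj' ; onto = onto' }
  where
  f' : ℕ → ℕ
  f' = update f w w'
  old : ∀ {x} → x ∈ℕ X → f' x ≡ f x
  old x∈ = update-other f w w' _ (∈⇒≢ x∈ w∉X)
  into' : ∀ x → x ∈ℕ (w ∷ X) → f' x ∈ℕ (w' ∷ Y)
  into' x (here refl) = here (update-same f w w')
  into' x (there x∈) = there (subst (_∈ℕ Y) (sym (old x∈)) (into b x x∈))
  inj' : ∀ x y → x ∈ℕ (w ∷ X) → y ∈ℕ (w ∷ X) → f' x ≡ f' y → x ≡ y
  inj' x y (here refl) (here refl) _ = refl
  inj' x y (here refl) (there y∈) eq =
    ⊥-elim (w'∉Y (subst (_∈ℕ Y) (trans (sym (old y∈)) (trans (sym eq) (update-same f w w'))) (into b y y∈)))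
  inj' x y (there x∈) (here refl) eq =
    ⊥-elim (w'∉Y (subst (_∈ℕ Y) (trans (sym (old x∈)) (trans eq (update-same f w w'))) (into b x x∈)))
  inj' x y (there x∈) (there y∈) eq = inj b x y x∈ y∈ (trans (sym (old x∈)) (trans eq (old y∈)))
  onto' : ∀ y → y ∈ℕ (w' ∷ Y) → ∃[ x ] (x ∈ℕ (w ∷ X) × f' x ≡ y)
  onto' y (here refl) = w , here refl , update-same f w w'
  onto' y (there y∈) with onto b y y∈
  ... | x , x∈ , refl = x , there x∈ , old x∈

piecewise : List ℕ → (ℕ → ℕ) → (ℕ → ℕ) → ℕ → ℕ
piecewise X f₁ f₂ x = if ⌊ x ∈ℕ? X ⌋ then f₁ x else f₂ x

piecewise-in : ∀ X f₁ f₂ {x} → x ∈ℕ X → piecewise X f₁ f₂ x ≡ f₁ x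
piecewise-in X f₁ f₂ {x} x∈ with x ∈ℕ? X
... | yes _ = refl
... | no x∉ = ⊥-elim (x∉ x∈)

piecewise-out : ∀ X f₁ f₂ {x} → ¬ (x ∈ℕ X) → piecewise X f₁ f₂ x ≡ f₂ x
piecewise-out X f₁ f₂ {x} x∉ with x ∈ℕ? X
... | yes x∈ = ⊥-elim (x∉ x∈)
... | no _ = refl

bijectionOn-++ : ∀ {f₁ f₂ X₁ X₂ Y₁ Y₂} → BijectionOn f₁ X₁ Y₁ → BijectionOn f₂ X₂ Y₂ →
  (∀ x → x ∈ℕ X₁ → x ∈ℕ X₂ → f₁ x ≡ f₂ x) →
  (∀ x y → x ∈ℕ X₁ → y ∈ℕ X₂ → f₁ x ≡ f₂ y → x ≡ y) →
  BijectionOn (piecewise X₁ f₁ f₂) (X₁ ++ X₂) (Y₁ ++ Y₂)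
bijectionOn-++ {f₁} {f₂} {X₁} {X₂} {Y₁} {Y₂} b₁ b₂ agree cross = record { into = into' ; inj = inj' ; onto = onto' }
  where
  f : ℕ → ℕ
  f = piecewise X₁ f₁ f₂
  into' : ∀ x → x ∈ℕ (X₁ ++ X₂) → f x ∈ℕ (Y₁ ++ Y₂)
  into' x x∈ with x ∈ℕ? X₁ | ∈-++⁻ X₁ x∈
  ... | yes x∈₁ | _ = ∈-++⁺ˡ (into b₁ x x∈₁)
  ... | no x∉₁ | inj₁ x∈₁ = ⊥-elim (x∉₁ x∈₁)
  ... | no _ | inj₂ x∈₂ = ∈-++⁺ʳ Y₁ (into b₂ x x∈₂)
  inj' : ∀ x y → x ∈ℕ (X₁ ++ X₂) → y ∈ℕ (X₁ ++ X₂) → f x ≡ f y → x ≡ y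
  inj' x y x∈ y∈ eq with x ∈ℕ? X₁ | y ∈ℕ? X₁ | ∈-++⁻ X₁ x∈ | ∈-++⁻ X₁ y∈
  ... | yes x∈₁ | yes y∈₁ | _ | _ = inj b₁ x y x∈₁ y∈₁ eq
  ... | yes x∈₁ | no _ | _ | inj₂ y∈₂ = cross x y x∈₁ y∈₂ eq
  ... | no _ | yes y∈₁ | inj₂ x∈₂ | _ = sym (cross y x y∈₁ x∈₂ (sym eq))
  ... | no _ | no _ | inj₂ x∈₂ | inj₂ y∈₂ = inj b₂ x y x∈₂ y∈₂ eq
  ... | _ | no y∉₁ | _ | inj₁ y∈₁ = ⊥-elim (y∉₁ y∈₁)
  ... | no x∉₁ | _ | inj₁ x∈₁ | _ = ⊥-elim (x∉₁ x∈₁)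
  onto' : ∀ y → y ∈ℕ (Y₁ ++ Y₂) → ∃[ x ] (x ∈ℕ (X₁ ++ X₂) × f x ≡ y)
  onto' y y∈ with ∈-++⁻ Y₁ y∈
  ... | inj₁ y∈₁ = let (x , x∈ , eq) = onto b₁ y y∈₁ in
        x , ∈-++⁺ˡ x∈ , trans (piecewise-in X₁ f₁ f₂ x∈) eq
  ... | inj₂ y∈₂ with onto b₂ y y∈₂
  ...   | x , x∈₂ , eq with x ∈ℕ? X₁
  ...     | yes x∈₁ = x , ∈-++⁺ˡ x∈₁ , trans (piecewise-in X₁ f₁ f₂ x∈₁) (trans (agree x x∈₁ x∈₂) eq)
  ...     | no x∉₁ = x , ∈-++⁺ʳ X₁ x∈₂ , trans (piecewise-out X₁ f₁ f₂ x∉₁) eq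

record Correspondence (H H' : Incidence) (VS ES VS' ES' : List ℕ) : Set where
  field
    vmap emap : ℕ → ℕ
    vbij : BijectionOn vmap VS VS'
    ebij : BijectionOn emap ES ES'
    incidence : ∀ e v → e ∈ℕ ES → v ∈ℕ VS →
      ((e , v) ∈I H → (emap e , vmap v) ∈I H') × ((emap e , vmap v) ∈I H' → (e , v) ∈I H)

invertOn : (ℕ → ℕ) → List ℕ → ℕ → ℕ
invertOn f [] w = 0
invertOn f (x ∷ xs) w = if ⌊ f x ℕ.≟ w ⌋ then x else invertOn f xs w

invertOn-correct : ∀ f xs w → ∃[ x ] (x ∈ℕ xs × f x ≡ w) → invertOn f xs w ∈ℕ xs × f (invertOn f xs w) ≡ w
invertOn-correct f [] w (x , () , _)
invertOn-correct f (y ∷ xs) w hit with f y ℕ.≟ w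
... | yes eq = here refl , eq
invertOn-correct f (y ∷ xs) w (x , here refl , eq) | no neq = ⊥-elim (neq eq)
invertOn-correct f (y ∷ xs) w (x , there x∈ , eq) | no _ =
  map₁ there (invertOn-correct f xs w (x , x∈ , eq))

correspondence⇒≃ : ∀ {G H VS ES VS' ES'} → Correspondence (I G) (I H) VS ES VS' ES' →
  VS ≐ V G → ES ≐ E G → VS' ≐ V H → ES' ≐ E H → G ≃ H
correspondence⇒≃ {G} {H} {VS} {ES} {VS'} {ES'} C eV eE eV' eE' = record
  { fV = vmap ; gV = invertOn vmap VS ; fE = emap ; gE = invertOn emap ES
  ; fV-into = λ v v∈ → proj₁ (eV' _) (into vbij v (proj₂ (eV v) v∈))
  ; gV-into = λ w w∈ → proj₁ (eV _) (proj₁ (inverseV w w∈))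
  ; gfV = λ v v∈ → leftInverse vbij (proj₂ (eV v) v∈)
  ; fgV = λ w w∈ → proj₂ (inverseV w w∈)
  ; fE-into = λ e e∈ → proj₁ (eE' _) (into ebij e (proj₂ (eE e) e∈))
  ; gE-into = λ e e∈ → proj₁ (eE _) (proj₁ (inverseE e e∈))
  ; gfE = λ e e∈ → leftInverse ebij (proj₂ (eE e) e∈)
  ; fgE = λ e e∈ → proj₂ (inverseE e e∈)
  ; inc = λ e v e∈ v∈ → let (to , from) = incidence e v (proj₂ (eE e) e∈) (proj₂ (eV v) v∈) in mk⇔ to from
  }
  where
  open Correspondence C
  leftInverse : ∀ {f X Y x} → BijectionOn f X Y → x ∈ℕ X → invertOn f X (f x) ≡ x
  leftInverse {f} {X} {x = x} b x∈ =
    let (y∈ , eq) = invertOn-correct f X (f x) (x , x∈ , refl) in inj b _ x y∈ x∈ eq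
  inverseV : ∀ w → w ∈ℕ V H → invertOn vmap VS w ∈ℕ VS × vmap (invertOn vmap VS w) ≡ w
  inverseV w w∈ = invertOn-correct vmap VS w (onto vbij w (proj₂ (eV' w) w∈))
  inverseE : ∀ e → e ∈ℕ E H → invertOn emap ES e ∈ℕ ES × emap (invertOn emap ES e) ≡ e
  inverseE e e∈ = invertOn-correct emap ES e (onto ebij e (proj₂ (eE' e) e∈))

≐-refl : ∀ {X} → X ≐ X
≐-refl x = (λ x∈ → x∈) , (λ x∈ → x∈)

≐-trans : ∀ {X Y Z} → X ≐ Y → Y ≐ Z → X ≐ Z
≐-trans X≐Y Y≐Z x = (λ x∈ → proj₁ (Y≐Z x) (proj₁ (X≐Y x) x∈)) , (λ x∈ → proj₂ (X≐Y x) (proj₂ (Y≐Z x) x∈))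

≐-∷ : ∀ {X Y} w → X ≐ Y → (w ∷ X) ≐ (w ∷ Y)
≐-∷ w X≐Y x = lift (proj₁ (X≐Y x)) , lift (proj₂ (X≐Y x))
  where
  lift : ∀ {A B : List ℕ} → (x ∈ℕ A → x ∈ℕ B) → x ∈ℕ (w ∷ A) → x ∈ℕ (w ∷ B)
  lift f (here refl) = here refl
  lift f (there x∈) = there (f x∈)

≐-++ : ∀ {X₁ X₂ Y₁ Y₂} → X₁ ≐ Y₁ → X₂ ≐ Y₂ → (X₁ ++ X₂) ≐ (Y₁ ++ Y₂)
≐-++ {X₁} {X₂} {Y₁} {Y₂} e₁ e₂ x = lift X₁ Y₁ (proj₁ (e₁ x)) (proj₁ (e₂ x)) , lift Y₁ X₁ (proj₂ (e₁ x)) (proj₂ (e₂ x))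
  where
  lift : ∀ A₁ B₁ {A₂ B₂} → (x ∈ℕ A₁ → x ∈ℕ B₁) → (x ∈ℕ A₂ → x ∈ℕ B₂) → x ∈ℕ (A₁ ++ A₂) → x ∈ℕ (B₁ ++ B₂)
  lift A₁ B₁ f₁ f₂ x∈ = [ (λ x∈₁ → ∈-++⁺ˡ (f₁ x∈₁)) , (λ x∈₂ → ∈-++⁺ʳ B₁ (f₂ x∈₂)) ] (∈-++⁻ A₁ x∈)

≐-map : ∀ {X Y} (f : ℕ → ℕ) → X ≐ Y → map f X ≐ map f Y
≐-map f X≐Y x = lift (λ y → proj₁ (X≐Y y)) , lift (λ y → proj₂ (X≐Y y))
  where
  lift : ∀ {A B : List ℕ} → (∀ y → y ∈ℕ A → y ∈ℕ B) → x ∈ℕ map f A → x ∈ℕ map f B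
  lift g x∈ with ∈-map⁻ f x∈
  ... | y , y∈ , refl = ∈-map⁺ f (g y y∈)

oneTo : ℕ → List ℕ
oneTo n = map suc (upTo n)

oneTo-positive : ∀ {n x} → x ∈ℕ oneTo n → 1 ≤ x
oneTo-positive x∈ with ∈-map⁻ suc x∈
... | _ , _ , refl = s≤s z≤n

oneTo-bounded : ∀ {n x} → x ∈ℕ oneTo n → x ≤ n
oneTo-bounded x∈ with ∈-map⁻ suc x∈
... | _ , y∈ , refl = ∈-upTo⁻ y∈

∈-oneTo⁺ : ∀ {n x} → 1 ≤ x → x ≤ n → x ∈ℕ oneTo n
∈-oneTo⁺ {x = suc y} _ x≤n = ∈-map⁺ suc (∈-upTo⁺ x≤n)

oneTo-mono : ∀ {m n x} → m ≤ n → x ∈ℕ oneTo m → x ∈ℕ oneTo n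
oneTo-mono m≤n x∈ = ∈-oneTo⁺ (oneTo-positive x∈) (ℕ.≤-trans (oneTo-bounded x∈) m≤n)

suc∉oneTo : ∀ n → ¬ (suc n ∈ℕ oneTo n)
suc∉oneTo n x∈ = ℕ.<-irrefl refl (oneTo-bounded x∈)

oneTo-suc : ∀ n → (suc n ∷ oneTo n) ≐ oneTo (suc n)
oneTo-suc n x = to , from
  where
  to : x ∈ℕ (suc n ∷ oneTo n) → x ∈ℕ oneTo (suc n)
  to (here refl) = ∈-oneTo⁺ (s≤s z≤n) ℕ.≤-refl
  to (there x∈) = oneTo-mono (ℕ.n≤1+n n) x∈
  from : x ∈ℕ oneTo (suc n) → x ∈ℕ (suc n ∷ oneTo n)
  from x∈ with ℕ.m≤n⇒m<n∨m≡n (oneTo-bounded x∈)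
  ... | inj₁ (s≤s x≤n) = there (∈-oneTo⁺ (oneTo-positive x∈) x≤n)
  ... | inj₂ refl = here refl

oneTo-+ : ∀ m n → (oneTo m ++ map (m +_) (oneTo n)) ≐ oneTo (m + n)
oneTo-+ m n x = to , from
  where
  to : x ∈ℕ (oneTo m ++ map (m +_) (oneTo n)) → x ∈ℕ oneTo (m + n)
  to x∈ with ∈-++⁻ (oneTo m) x∈
  ... | inj₁ x∈₁ = oneTo-mono (ℕ.m≤m+n m n) x∈₁
  ... | inj₂ x∈₂ with ∈-map⁻ (m +_) x∈₂
  ...   | y , y∈ , refl = ∈-oneTo⁺ (ℕ.≤-trans (oneTo-positive y∈) (ℕ.m≤n+m y m)) (ℕ.+-monoʳ-≤ m (oneTo-bounded y∈))
  from : x ∈ℕ oneTo (m + n) → x ∈ℕ (oneTo m ++ map (m +_) (oneTo n))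
  from x∈ with ℕ.≤-<-connex x m
  ... | inj₁ x≤m = ∈-++⁺ˡ (∈-oneTo⁺ (oneTo-positive x∈) x≤m)
  ... | inj₂ m<x = ∈-++⁺ʳ (oneTo m) (subst (_∈ℕ map (m +_) (oneTo n)) x≡m+d (∈-map⁺ (m +_) d∈))
    where
    x≡m+d : m + (x ∸ m) ≡ x
    x≡m+d = ℕ.m+[n∸m]≡n (ℕ.<⇒≤ m<x)
    d∈ : (x ∸ m) ∈ℕ oneTo n
    d∈ = ∈-oneTo⁺ (ℕ.m<n⇒0<n∸m m<x) (ℕ.+-cancelˡ-≤ m _ _ (subst (_≤ m + n) (sym x≡m+d) (oneTo-bounded x∈)))

data _[_]=_ {A : Set} : List A → ℕ → A → Set where
  first : ∀ {x xs} → (x ∷ xs) [ 0 ]= x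
  later : ∀ {x xs j y} → xs [ j ]= y → (x ∷ xs) [ suc j ]= y

[]=-functional : ∀ {A : Set} {xs : List A} {j p q} → xs [ j ]= p → xs [ j ]= q → p ≡ q
[]=-functional first first = refl
[]=-functional (later a) (later b) = []=-functional a b

[]=-exists : ∀ {A : Set} (xs : List A) j → j < length xs → ∃[ p ] (xs [ j ]= p)
[]=-exists (x ∷ xs) zero _ = x , first
[]=-exists (x ∷ xs) (suc j) (s≤s j<) = map₂ later ([]=-exists xs j j<)

[]=-++ˡ : ∀ {A : Set} {xs ys : List A} {j p} → xs [ j ]= p → (xs ++ ys) [ j ]= p
[]=-++ˡ first = first
[]=-++ˡ (later a) = later ([]=-++ˡ a)

[]=-++ʳ : ∀ {A : Set} (xs : List A) {ys j p} → ys [ j ]= p → (xs ++ ys) [ length xs + j ]= p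
[]=-++ʳ [] a = a
[]=-++ʳ (x ∷ xs) a = later ([]=-++ʳ xs a)

[]=-map : ∀ {A B : Set} (f : A → B) {xs j p} → xs [ j ]= p → map f xs [ j ]= f p
[]=-map f first = first
[]=-map f (later a) = later ([]=-map f a)

∈-incidences⁻ : ∀ {i es e v} → (e , v) ∈I incidences i es →
  ∃[ j ] ∃[ a ] ∃[ b ] (es [ j ]= (a , b) × e ≡ suc (i + j) × (v ≡ a ⊎ v ≡ b))
∈-incidences⁻ {i} {(a , b) ∷ es} (here refl) = 0 , a , b , first , cong suc (sym (ℕ.+-identityʳ i)) , inj₁ refl
∈-incidences⁻ {i} {(a , b) ∷ es} (there (here refl)) = 0 , a , b , first , cong suc (sym (ℕ.+-identityʳ i)) , inj₂ refl
∈-incidences⁻ {i} {(a , b) ∷ es} (there (there e∈)) with ∈-incidences⁻ {suc i} {es} e∈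
... | j , a' , b' , at , refl , v≡ = suc j , a' , b' , later at , cong suc (sym (ℕ.+-suc i j)) , v≡

∈-incidences⁺ : ∀ {i es j a b v} → es [ j ]= (a , b) → (v ≡ a ⊎ v ≡ b) → (suc (i + j) , v) ∈I incidences i es
∈-incidences⁺ {i} first (inj₁ refl) rewrite ℕ.+-identityʳ i = here refl
∈-incidences⁺ {i} first (inj₂ refl) rewrite ℕ.+-identityʳ i = there (here refl)
∈-incidences⁺ {i} {_ ∷ es} {suc j} (later at) v≡ rewrite ℕ.+-suc i j = there (there (∈-incidences⁺ {suc i} {es} at v≡))

incidences-ends : ∀ {es j a b} → es [ j ]= (a , b) → Ends (incidences 0 es) (suc j) a b
incidences-ends {es} {j} {a} {b} at v = to , ∈-incidences⁺ {0} at
  where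
  to : (suc j , v) ∈I incidences 0 es → v ≡ a ⊎ v ≡ b
  to v∈ with ∈-incidences⁻ {0} v∈
  ... | j' , a' , b' , at' , refl , v≡ with []=-functional at at'
  ... | refl = v≡

PairIncluded : ℕ → ℕ → ℕ → ℕ → Set
PairIncluded a b c d = ∀ x → x ≡ a ⊎ x ≡ b → x ≡ c ⊎ x ≡ d

Ends-resp : ∀ {H e a b c d} → Ends H e a b → PairIncluded a b c d → PairIncluded c d a b → Ends H e c d
Ends-resp ends ab⊆cd cd⊆ab v = (λ v∈ → ab⊆cd v (proj₁ (ends v) v∈)) , (λ v≡ → proj₂ (ends v) (cd⊆ab v v≡))

Ends-included : ∀ {H e a b c d} → Ends H e a b → Ends H e c d → PairIncluded a b c d
Ends-included ends ends' v v≡ = proj₁ (ends' v) (proj₂ (ends v) v≡)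

PairIncluded-map : ∀ (φ : ℕ → ℕ) {a b c d} → PairIncluded a b c d → PairIncluded (φ a) (φ b) (φ c) (φ d)
PairIncluded-map φ {a} {b} ab⊆cd x (inj₁ refl) = Sum.map (cong φ) (cong φ) (ab⊆cd a (inj₁ refl))
PairIncluded-map φ {a} {b} ab⊆cd x (inj₂ refl) = Sum.map (cong φ) (cong φ) (ab⊆cd b (inj₂ refl))

incidences-ends-embed : ∀ (es es' : List (ℕ × ℕ)) (φ : ℕ → ℕ) (o : ℕ) →
  (∀ j p → es [ j ]= p → es' [ o + j ]= (φ (proj₁ p) , φ (proj₂ p))) →
  ∀ e a b → e ∈ℕ oneTo (length es) → Ends (incidences 0 es) e a b → Ends (incidences 0 es') (o + e) (φ a) (φ b)
incidences-ends-embed es es' φ o embed zero a b e∈ ends = ⊥-elim (ℕ.<-irrefl refl (oneTo-positive e∈))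
incidences-ends-embed es es' φ o embed (suc j) a b e∈ ends with []=-exists es j (oneTo-bounded e∈)
... | (a' , b') , at =
  Ends-resp ends' (PairIncluded-map φ (Ends-included (incidences-ends at) ends)) (PairIncluded-map φ (Ends-included ends (incidences-ends at)))
  where
  ends' : Ends (incidences 0 es') (o + suc j) (φ a') (φ b')
  ends' = subst (λ z → Ends (incidences 0 es') z (φ a') (φ b')) (sym (ℕ.+-suc o j)) (incidences-ends (embed j (a' , b') at))

Unique-map-local : ∀ {A B : Set} (f : A → B) {xs : List A} → Unique xs →
  (∀ x y → x ∈ xs → y ∈ xs → f x ≡ f y → x ≡ y) → Unique (map f xs)
Unique-map-local f [] _ = []
Unique-map-local f {x ∷ xs} (x∉ ∷ uniq) f-inj =
  All.tabulate (λ fy∈ fx≡ → let (y , y∈ , fy≡) = ∈-map⁻ f fy∈ in All.lookup x∉ y∈ (f-inj x y (here refl) (there y∈) (trans fx≡ fy≡)))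
  ∷ Unique-map-local f uniq (λ a b a∈ b∈ → f-inj a b (there a∈) (there b∈))

-- Paths in trees and gluing of trees

Adj-sym : ∀ {T a b} → Adj T a b → Adj T b a
Adj-sym (up i) = down i
Adj-sym (down i) = up i

PathIn-head : ∀ {T P a b} → PathIn T P a b → P a
PathIn-head (here p) = p
PathIn-head (step p _ _) = p

PathIn-++ : ∀ {T P a b c} → PathIn T P a b → PathIn T P b c → PathIn T P a c
PathIn-++ (here _) q = q
PathIn-++ (step p a r) q = step p a (PathIn-++ r q)

PathIn-reverse : ∀ {T P a b} → PathIn T P a b → PathIn T P b a
PathIn-reverse (here p) = here p
PathIn-reverse (step p a r) = PathIn-++ (PathIn-reverse r) (step (PathIn-head r) (Adj-sym a) (here p))

PathIn-map : ∀ {T T' : Tree} {P : Node T → Set} {Q : Node T' → Set} (f : Node T → Node T') →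
  (∀ {a b} → Adj T a b → Adj T' (f a) (f b)) → (∀ x → P x → Q (f x)) →
  ∀ {a b} → PathIn T P a b → PathIn T' Q (f a) (f b)
PathIn-map f f-adj f-P (here p) = here (f-P _ p)
PathIn-map f f-adj f-P (step p a r) = step (f-P _ p) (f-adj a) (PathIn-map f f-adj f-P r)

PathIn-weaken : ∀ {T : Tree} {P Q : Node T → Set} → (∀ x → P x → Q x) → ∀ {a b} → PathIn T P a b → PathIn T Q a b
PathIn-weaken {T} = PathIn-map {T} {T} (λ x → x) (λ a → a)

record BagTree : Set where
  field
    shape : Tree
    bags : Node shape → List ℕ
    bags-connected : ∀ v s t → v ∈ℕ bags s → v ∈ℕ bags t → PathIn shape (λ x → v ∈ℕ bags x) s t
open BagTree

-- Nodes of T₁ first, then those of T₂; the root of T₂ becomes a child of the root of T₁.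
module Gluing (T₁ T₂ : Tree) where

  private
    m₁ m₂ : ℕ
    m₁ = m T₁
    m₂ = m T₂

  GluedNode : Set
  GluedNode = Fin (suc (m₁ + suc m₂))

  left : Node T₁ → GluedNode
  left a = a ↑ˡ suc m₂

  right : Node T₂ → GluedNode
  right c = suc m₁ ↑ʳ c

  gluedParent : Fin (m₁ + suc m₂) → GluedNode
  gluedParent i with splitAt m₁ i
  ... | inj₁ i₁ = left (parent T₁ i₁)
  ... | inj₂ fzero = fzero
  ... | inj₂ (fsuc i₂) = right (parent T₂ i₂)

  gluedParent-< : ∀ i → toℕ (gluedParent i) ≤ toℕ i
  gluedParent-< i with splitAt m₁ i in eq
  ... | inj₁ i₁ rewrite sym (Fin.splitAt⁻¹-↑ˡ eq) | Fin.toℕ-↑ˡ (parent T₁ i₁) (suc m₂) | Fin.toℕ-↑ˡ i₁ (suc m₂) =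
    parent-< T₁ i₁
  ... | inj₂ fzero = z≤n
  ... | inj₂ (fsuc i₂) rewrite sym (Fin.splitAt⁻¹-↑ʳ eq) | Fin.toℕ-↑ʳ (suc m₁) (parent T₂ i₂)
                             | Fin.toℕ-↑ʳ m₁ (fsuc i₂) | ℕ.+-suc m₁ (toℕ i₂) =
    s≤s (ℕ.+-monoʳ-≤ m₁ (parent-< T₂ i₂))

  glued : Tree
  glued = record { m = m₁ + suc m₂ ; parent = gluedParent ; parent-< = gluedParent-< }

  gluedParent-left : ∀ i → gluedParent (i ↑ˡ suc m₂) ≡ left (parent T₁ i)
  gluedParent-left i rewrite Fin.splitAt-↑ˡ m₁ i (suc m₂) = refl

  gluedParent-rightRoot : gluedParent (m₁ ↑ʳ fzero) ≡ fzero
  gluedParent-rightRoot rewrite Fin.splitAt-↑ʳ m₁ (suc m₂) fzero = refl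

  gluedParent-right : ∀ i → gluedParent (m₁ ↑ʳ fsuc i) ≡ right (parent T₂ i)
  gluedParent-right i rewrite Fin.splitAt-↑ʳ m₁ (suc m₂) (fsuc i) = refl

  Adj-left : ∀ {a b} → Adj T₁ a b → Adj glued (left a) (left b)
  Adj-left (up i) = subst (Adj glued (fsuc (i ↑ˡ suc m₂))) (gluedParent-left i) (up (i ↑ˡ suc m₂))
  Adj-left (down i) = subst (λ y → Adj glued y (fsuc (i ↑ˡ suc m₂))) (gluedParent-left i) (down (i ↑ˡ suc m₂))

  Adj-right : ∀ {a b} → Adj T₂ a b → Adj glued (right a) (right b)
  Adj-right (up i) = subst (Adj glued (fsuc (m₁ ↑ʳ fsuc i))) (gluedParent-right i) (up (m₁ ↑ʳ fsuc i))
  Adj-right (down i) = subst (λ y → Adj glued y (fsuc (m₁ ↑ʳ fsuc i))) (gluedParent-right i) (down (m₁ ↑ʳ fsuc i))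

  Adj-roots : Adj glued fzero (right fzero)
  Adj-roots = subst (λ y → Adj glued y (fsuc (m₁ ↑ʳ fzero))) gluedParent-rightRoot (down (m₁ ↑ʳ fzero))

  left-or-right : ∀ (x : GluedNode) → (∃[ a ] (x ≡ left a)) ⊎ (∃[ c ] (x ≡ right c))
  left-or-right x with splitAt (suc m₁) x in eq
  ... | inj₁ a = inj₁ (a , sym (Fin.splitAt⁻¹-↑ˡ eq))
  ... | inj₂ c = inj₂ (c , sym (Fin.splitAt⁻¹-↑ʳ eq))

  both : ∀ {A : Set} → (Node T₁ → A) → (Node T₂ → A) → GluedNode → A
  both f g x = [ f , g ] (splitAt (suc m₁) x)

  both-left : ∀ {A : Set} (f : Node T₁ → A) (g : Node T₂ → A) a → both f g (left a) ≡ f a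
  both-left f g a rewrite Fin.splitAt-↑ˡ (suc m₁) a (suc m₂) = refl

  both-right : ∀ {A : Set} (f : Node T₁ → A) (g : Node T₂ → A) c → both f g (right c) ≡ g c
  both-right f g c rewrite Fin.splitAt-↑ʳ (suc m₁) (suc m₂) c = refl

SharedInRoots : BagTree → BagTree → Set
SharedInRoots D₁ D₂ = ∀ v s t → v ∈ℕ bags D₁ s → v ∈ℕ bags D₂ t → v ∈ℕ bags D₁ fzero × v ∈ℕ bags D₂ fzero

glue : (D₁ D₂ : BagTree) → SharedInRoots D₁ D₂ → BagTree
glue D₁ D₂ shared-in-roots = record { shape = glued ; bags = bags' ; bags-connected = connected' }
  where
  open Gluing (shape D₁) (shape D₂)
  bags' : GluedNode → List ℕ
  bags' = both (bags D₁) (bags D₂)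
  inL : ∀ v a → v ∈ℕ bags D₁ a → v ∈ℕ bags' (left a)
  inL v a = subst (v ∈ℕ_) (sym (both-left (bags D₁) (bags D₂) a))
  inR : ∀ v c → v ∈ℕ bags D₂ c → v ∈ℕ bags' (right c)
  inR v c = subst (v ∈ℕ_) (sym (both-right (bags D₁) (bags D₂) c))
  outL : ∀ v a → v ∈ℕ bags' (left a) → v ∈ℕ bags D₁ a
  outL v a = subst (v ∈ℕ_) (both-left (bags D₁) (bags D₂) a)
  outR : ∀ v c → v ∈ℕ bags' (right c) → v ∈ℕ bags D₂ c
  outR v c = subst (v ∈ℕ_) (both-right (bags D₁) (bags D₂) c)
  pathL : ∀ v {a a'} → PathIn (shape D₁) (λ x → v ∈ℕ bags D₁ x) a a' → PathIn glued (λ x → v ∈ℕ bags' x) (left a) (left a')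
  pathL v = PathIn-map left Adj-left (inL v)
  pathR : ∀ v {c c'} → PathIn (shape D₂) (λ x → v ∈ℕ bags D₂ x) c c' → PathIn glued (λ x → v ∈ℕ bags' x) (right c) (right c')
  pathR v = PathIn-map right Adj-right (inR v)
  pathLR : ∀ v a c → v ∈ℕ bags D₁ a → v ∈ℕ bags D₂ c → PathIn glued (λ x → v ∈ℕ bags' x) (left a) (right c)
  pathLR v a c v∈a v∈c =
    let (v∈root₁ , v∈root₂) = shared-in-roots v a c v∈a v∈c in
    PathIn-++ (pathL v (bags-connected D₁ v a fzero v∈a v∈root₁))
              (step (inL v fzero v∈root₁) Adj-roots (pathR v (bags-connected D₂ v fzero c v∈root₂ v∈c)))
  connected' : ∀ v s t → v ∈ℕ bags' s → v ∈ℕ bags' t → PathIn glued (λ x → v ∈ℕ bags' x) s t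
  connected' v s t v∈s v∈t with left-or-right s | left-or-right t
  ... | inj₁ (a , refl) | inj₁ (a' , refl) = pathL v (bags-connected D₁ v a a' (outL v a v∈s) (outL v a' v∈t))
  ... | inj₂ (c , refl) | inj₂ (c' , refl) = pathR v (bags-connected D₂ v c c' (outR v c v∈s) (outR v c' v∈t))
  ... | inj₁ (a , refl) | inj₂ (c , refl) = pathLR v a c (outL v a v∈s) (outR v c v∈t)
  ... | inj₂ (c , refl) | inj₁ (a , refl) = PathIn-reverse (pathLR v a c (outL v a v∈t) (outR v c v∈s))

singleBag : List ℕ → BagTree
singleBag X = record { shape = point ; bags = λ _ → X ; bags-connected = connected' }
  where
  point : Tree
  point = record { m = 0 ; parent = λ () ; parent-< = λ () }
  connected' : ∀ v (s t : Fin 1) → v ∈ℕ X → v ∈ℕ X → PathIn point (λ _ → v ∈ℕ X) s t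
  connected' v fzero fzero v∈ _ = here v∈

module _ (D₁ D₂ : BagTree) (shared : SharedInRoots D₁ D₂) where

  glue-all : ∀ (P : List ℕ → Set) → (∀ a → P (bags D₁ a)) → (∀ c → P (bags D₂ c)) → ∀ x → P (bags (glue D₁ D₂ shared) x)
  glue-all P all₁ all₂ x with splitAt (suc (m (shape D₁))) x
  ... | inj₁ a = all₁ a
  ... | inj₂ c = all₂ c

  glue-∃ˡ : ∀ (P : List ℕ → Set) a → P (bags D₁ a) → ∃[ x ] P (bags (glue D₁ D₂ shared) x)
  glue-∃ˡ P a p = Gluing.left (shape D₁) (shape D₂) a ,
    subst P (sym (Gluing.both-left (shape D₁) (shape D₂) (bags D₁) (bags D₂) a)) p

  glue-∃ʳ : ∀ (P : List ℕ → Set) c → P (bags D₂ c) → ∃[ x ] P (bags (glue D₁ D₂ shared) x)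
  glue-∃ʳ P c p = Gluing.right (shape D₁) (shape D₂) c ,
    subst P (sym (Gluing.both-right (shape D₁) (shape D₂) (bags D₁) (bags D₂) c)) p

module Descendants (T : Tree) where

  infix 4 _≼_

  data _≼_ (t : Node T) : Node T → Set where
    ≼-refl : t ≼ t
    ≼-step : ∀ i → t ≼ parent T i → t ≼ fsuc i

  parent< : ∀ i → toℕ (parent T i) < toℕ (fsuc {m T} i)
  parent< i = s≤s (parent-< T i)

  ≼⇒toℕ≤ : ∀ {t y} → t ≼ y → toℕ t ≤ toℕ y
  ≼⇒toℕ≤ ≼-refl = ℕ.≤-refl
  ≼⇒toℕ≤ (≼-step i t≼) = ℕ.≤-trans (≼⇒toℕ≤ t≼) (ℕ.<⇒≤ (parent< i))

  parent⋠child : ∀ i → ¬ (fsuc i ≼ parent T i)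
  parent⋠child i child≼ = ℕ.<⇒≱ (parent< i) (≼⇒toℕ≤ child≼)

  ≼-child : ∀ {t} i → parent T i ≡ t → t ≼ fsuc i
  ≼-child i refl = ≼-step i ≼-refl

  ≼-trans : ∀ {a b c} → a ≼ b → b ≼ c → a ≼ c
  ≼-trans a≼b ≼-refl = a≼b
  ≼-trans a≼b (≼-step i b≼) = ≼-step i (≼-trans a≼b b≼)

  private
    ≼?-fuel : ∀ n t y → toℕ y < n → Dec (t ≼ y)
    ≼?-fuel (suc n) t y _ with y Fin.≟ t
    ... | yes refl = yes ≼-refl
    ≼?-fuel (suc n) t fzero _ | no y≢t = no λ { ≼-refl → y≢t refl }
    ≼?-fuel (suc n) t (fsuc i) (s≤s y<) | no y≢t with ≼?-fuel n t (parent T i) (ℕ.≤-<-trans (parent-< T i) y<)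
    ... | yes t≼ = yes (≼-step i t≼)
    ... | no t⋠ = no λ { ≼-refl → y≢t refl ; (≼-step .i t≼) → t⋠ t≼ }

    root≼-fuel : ∀ n y → toℕ y < n → fzero ≼ y
    root≼-fuel (suc n) fzero _ = ≼-refl
    root≼-fuel (suc n) (fsuc i) (s≤s y<) = ≼-step i (root≼-fuel n (parent T i) (ℕ.≤-<-trans (parent-< T i) y<))

  _≼?_ : ∀ t y → Dec (t ≼ y)
  t ≼? y = ≼?-fuel (suc (toℕ y)) t y ℕ.≤-refl

  root≼ : ∀ y → fzero ≼ y
  root≼ y = root≼-fuel (suc (toℕ y)) y ℕ.≤-refl

  ≼-split : ∀ {t y} → t ≼ y → y ≡ t ⊎ ∃[ i ] (parent T i ≡ t × fsuc i ≼ y)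
  ≼-split ≼-refl = inj₁ refl
  ≼-split (≼-step i t≼) with ≼-split t≼
  ... | inj₁ refl = inj₂ (i , refl , ≼-refl)
  ... | inj₂ (j , eq , child≼) = inj₂ (j , eq , ≼-step i child≼)

  ≼-comparable : ∀ {a b y} → a ≼ y → b ≼ y → a ≼ b ⊎ b ≼ a
  ≼-comparable ≼-refl b≼ = inj₂ b≼
  ≼-comparable (≼-step i a≼) ≼-refl = inj₁ (≼-step i a≼)
  ≼-comparable (≼-step i a≼) (≼-step .i b≼) = ≼-comparable a≼ b≼

  child-unique : ∀ {t y} i j → parent T i ≡ t → parent T j ≡ t → fsuc i ≼ y → fsuc j ≼ y → i ≡ j
  child-unique i j pi≡ pj≡ i≼ j≼ with ≼-comparable i≼ j≼
  ... | inj₁ ≼-refl = refl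
  ... | inj₁ (≼-step .j i≼pj) = ⊥-elim (parent⋠child i (subst (fsuc i ≼_) (trans pj≡ (sym pi≡)) i≼pj))
  ... | inj₂ ≼-refl = refl
  ... | inj₂ (≼-step .i j≼pi) = ⊥-elim (parent⋠child j (subst (fsuc j ≼_) (trans pi≡ (sym pj≡)) j≼pi))

  PathIn-leaves-subtree : ∀ {P : Node T → Set} {a b} i → PathIn T P a b → fsuc i ≼ a → ¬ (fsuc i ≼ b) →
    P (fsuc i) × P (parent T i)
  PathIn-leaves-subtree i (here p) i≼a i⋠b = ⊥-elim (i⋠b i≼a)
  PathIn-leaves-subtree {P} i (step {s' = a'} p adj r) i≼a i⋠b with fsuc i ≼? a'
  ... | yes i≼a' = PathIn-leaves-subtree i r i≼a' i⋠b
  ... | no i⋠a' = crossing adj i≼a i⋠a' p (PathIn-head r)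
    where
    crossing : ∀ {x y} → Adj T x y → fsuc i ≼ x → ¬ (fsuc i ≼ y) → P x → P y → P (fsuc i) × P (parent T i)
    crossing (up j) ≼-refl _ px py = px , py
    crossing (up j) (≼-step .j i≼) i⋠ _ _ = ⊥-elim (i⋠ i≼)
    crossing (down j) i≼ i⋠ _ _ = ⊥-elim (i⋠ (≼-step j i≼))

treewidth-resp-≃ : ∀ {G H k} → IsGraph H → G ≃ H → TreewidthAtMost G k → TreewidthAtMost H k
treewidth-resp-≃ {G} {H} {k} isGraph iso (D , width) = record
  { tree = tree D ; bag = bag'
  ; bag-unique = λ t → Unique-map-local fV (bag-unique D t) (λ x y x∈ y∈ → fV-inj x y (bag-sub D t x x∈) (bag-sub D t y y∈))
  ; bag-sub = bag-sub'
  ; cover-vertices = cover-vertices'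
  ; cover-edges = cover-edges'
  ; connected = connected' } , λ t → subst (_≤ suc k) (sym (List.length-map fV (bag D t))) (width t)
  where
  open _≃_ iso
  bag' : Node (tree D) → List ℕ
  bag' t = map fV (bag D t)
  fV-inj : ∀ x y → x ∈ℕ V G → y ∈ℕ V G → fV x ≡ fV y → x ≡ y
  fV-inj x y x∈ y∈ eq = trans (sym (gfV x x∈)) (trans (cong gV eq) (gfV y y∈))
  bag-sub' : ∀ t v → v ∈ℕ bag' t → v ∈ℕ V H
  bag-sub' t v v∈ with ∈-map⁻ fV v∈
  ... | x , x∈ , refl = fV-into x (bag-sub D t x x∈)
  cover-vertices' : ∀ v → v ∈ℕ V H → ∃[ t ] (v ∈ℕ bag' t)
  cover-vertices' v v∈ with cover-vertices D (gV v) (gV-into v v∈)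
  ... | t , gv∈ = t , subst (_∈ℕ bag' t) (fgV v v∈) (∈-map⁺ fV gv∈)
  cover-edges' : ∀ e → e ∈ℕ E H → ∃[ t ] (∀ v → (e , v) ∈I I H → v ∈ℕ bag' t)
  cover-edges' e e∈ with cover-edges D (gE e) (gE-into e e∈)
  ... | t , covered = t , λ v inc →
    let v∈ = proj₂ (IsGraph.inc-sub isGraph e v inc)
        inc' = Equivalence.from (_≃_.inc iso (gE e) (gV v) (gE-into e e∈) (gV-into v v∈))
                 (subst₂ (λ a b → (a , b) ∈I I H) (sym (fgE e e∈)) (sym (fgV v v∈)) inc)
    in subst (_∈ℕ bag' t) (fgV v v∈) (∈-map⁺ fV (covered (gV v) inc'))
  connected' : ∀ v s t → v ∈ℕ bag' s → v ∈ℕ bag' t → PathIn (tree D) (λ x → v ∈ℕ bag' x) s t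
  connected' v s t v∈s v∈t with ∈-map⁻ fV v∈s | ∈-map⁻ fV v∈t
  ... | x , x∈ , refl | y , y∈ , eq with fV-inj x y (bag-sub D s x x∈) (bag-sub D t y y∈) eq
  ... | refl = PathIn-weaken (λ z z∈ → ∈-map⁺ fV z∈) (connected D x s t x∈ y∈)

-- Realisations of instructive terms

module Instructive (k : ℕ) where

  Label : Set
  Label = Fin (suc k)

  LabelSet : Set
  LabelSet = Subset (suc k)

  -- The vertices VS and edges ES of H, with the labelling α, are built exactly as
  -- G(τ) is built, up to the names chosen for new vertices and edges.
  data Realises (H : Incidence) : {B : LabelSet} → ITD k B → List ℕ → List ℕ → (Label → ℕ) → Set where
    leaf : ∀ {α} → Realises H Leaf [] [] α
    introVertex : ∀ {B u} {u∉ : u ∉s B} {σ : ITD k B} {VS ES α α' w} →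
      Realises H σ VS ES α → ¬ (w ∈ℕ VS) → (∀ x → α' x ≡ update α u w x) →
      Realises H (IntroVertex u u∉ σ) (w ∷ VS) ES α'
    forgetVertex : ∀ {B u} {u∈ : u ∈s B} {σ : ITD k B} {VS ES α α'} →
      Realises H σ VS ES α → (∀ x → α' x ≡ α x) →
      Realises H (ForgetVertex u u∈ σ) VS ES α'
    introEdge : ∀ {B u v} {u≢v : u ≢ v} {u∈ : u ∈s B} {v∈ : v ∈s B} {σ : ITD k B} {VS ES α α' e} →
      Realises H σ VS ES α → ¬ (e ∈ℕ ES) → Ends H e (α u) (α v) → (∀ x → α' x ≡ α x) →
      Realises H (IntroEdge u v u≢v u∈ v∈ σ) VS (e ∷ ES) α'
    join : ∀ {B} {σ₁ σ₂ : ITD k B} {VS₁ ES₁ α₁ VS₂ ES₂ α₂ α'} →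
      Realises H σ₁ VS₁ ES₁ α₁ → Realises H σ₂ VS₂ ES₂ α₂ →
      (∀ u → u ∈s B → α₂ u ≡ α₁ u) →
      (∀ x → x ∈ℕ VS₁ → x ∈ℕ VS₂ → ∃[ u ] (u ∈s B × x ≡ α₁ u)) →
      (∀ e → e ∈ℕ ES₁ → ¬ (e ∈ℕ ES₂)) → (∀ x → α' x ≡ α₁ x) →
      Realises H (Join σ₁ σ₂) (VS₁ ++ VS₂) (ES₁ ++ ES₂) α'

  module _ {H : Incidence} where

    active∈ : ∀ {B} {τ : ITD k B} {VS ES α} → Realises H τ VS ES α → ∀ u → u ∈s B → α u ∈ℕ VS
    active∈ leaf u u∈ = ⊥-elim (Subset.∉⊥ u∈)
    active∈ (introVertex {B} {u = u} {u∉ = u∉} {α = α} {w = w} r w∉ α'≡) x x∈ with x∈p∪⁅y⁆⁻ x∈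
    ... | inj₁ x∈B = there (subst (_∈ℕ _) (sym (trans (α'≡ x) (update-other α u w x λ { refl → u∉ x∈B }))) (active∈ r x x∈B))
    ... | inj₂ refl = here (trans (α'≡ x) (update-same α u w))
    active∈ (forgetVertex r α'≡) x x∈ = subst (_∈ℕ _) (sym (α'≡ x)) (active∈ r x (proj₁ (x∈p-y⇒x∈p×x≢y x∈)))
    active∈ (introEdge r _ _ α'≡) x x∈ = subst (_∈ℕ _) (sym (α'≡ x)) (active∈ r x x∈)
    active∈ (join r₁ _ _ _ _ α'≡) x x∈ = ∈-++⁺ˡ (subst (_∈ℕ _) (sym (α'≡ x)) (active∈ r₁ x x∈))

    active-injective : ∀ {B} {τ : ITD k B} {VS ES α} → Realises H τ VS ES α →
      ∀ u v → u ∈s B → v ∈s B → α u ≡ α v → u ≡ v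
    active-injective leaf u v u∈ _ _ = ⊥-elim (Subset.∉⊥ u∈)
    active-injective (introVertex {B} {u = u₀} {u∉ = u∉} {α = α} {α'} {w} r w∉ α'≡) u v u∈ v∈ eq
      with x∈p∪⁅y⁆⁻ u∈ | x∈p∪⁅y⁆⁻ v∈
    ... | inj₁ u∈B | inj₁ v∈B = active-injective r u v u∈B v∈B (trans (sym (old u∈B)) (trans eq (old v∈B)))
      where
      old : ∀ {x} → x ∈s B → α' x ≡ α x
      old {x} x∈B = trans (α'≡ x) (update-other α u₀ w x λ { refl → u∉ x∈B })
    ... | inj₁ u∈B | inj₂ refl =
      ⊥-elim (w∉ (subst (_∈ℕ _) (trans (sym (trans (α'≡ u) (update-other α v w u λ { refl → u∉ u∈B })))
                                        (trans eq (trans (α'≡ v) (update-same α v w)))) (active∈ r u u∈B)))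
    ... | inj₂ refl | inj₁ v∈B =
      ⊥-elim (w∉ (subst (_∈ℕ _) (trans (sym (trans (α'≡ v) (update-other α u w v λ { refl → u∉ v∈B })))
                                        (trans (sym eq) (trans (α'≡ u) (update-same α u w)))) (active∈ r v v∈B)))
    ... | inj₂ refl | inj₂ refl = refl
    active-injective (forgetVertex r α'≡) u v u∈ v∈ eq =
      active-injective r u v (proj₁ (x∈p-y⇒x∈p×x≢y u∈)) (proj₁ (x∈p-y⇒x∈p×x≢y v∈)) (trans (sym (α'≡ u)) (trans eq (α'≡ v)))
    active-injective (introEdge r _ _ α'≡) u v u∈ v∈ eq = active-injective r u v u∈ v∈ (trans (sym (α'≡ u)) (trans eq (α'≡ v)))
    active-injective (join r₁ _ _ _ _ α'≡) u v u∈ v∈ eq = active-injective r₁ u v u∈ v∈ (trans (sym (α'≡ u)) (trans eq (α'≡ v)))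

    EdgeWithin : List ℕ → ℕ → Set
    EdgeWithin VS e = ∃[ a ] ∃[ b ] (a ∈ℕ VS × b ∈ℕ VS × Ends H e a b)

    edge-within : ∀ {B} {τ : ITD k B} {VS ES α} → Realises H τ VS ES α → ∀ e → e ∈ℕ ES → EdgeWithin VS e
    edge-within leaf e ()
    edge-within (introVertex r _ _) e e∈ = let (a , b , a∈ , b∈ , ends) = edge-within r e e∈ in a , b , there a∈ , there b∈ , ends
    edge-within (forgetVertex r _) e e∈ = edge-within r e e∈
    edge-within (introEdge {u = u} {v} {u∈ = u∈} {v∈} {α = α} r _ ends _) e (here refl) = α u , α v , active∈ r u u∈ , active∈ r v v∈ , ends
    edge-within (introEdge r _ _ _) e (there e∈) = edge-within r e e∈
    edge-within (join {VS₁ = VS₁} r₁ r₂ _ _ _ _) e e∈ with ∈-++⁻ _ e∈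
    ... | inj₁ e∈₁ = let (a , b , a∈ , b∈ , ends) = edge-within r₁ e e∈₁ in a , b , ∈-++⁺ˡ a∈ , ∈-++⁺ˡ b∈ , ends
    ... | inj₂ e∈₂ = let (a , b , a∈ , b∈ , ends) = edge-within r₂ e e∈₂ in a , b , ∈-++⁺ʳ VS₁ a∈ , ∈-++⁺ʳ VS₁ b∈ , ends

    incident∈ : ∀ {VS e v} → EdgeWithin VS e → (e , v) ∈I H → v ∈ℕ VS
    incident∈ (a , b , a∈ , b∈ , ends) v∈ with proj₁ (ends _) v∈
    ... | inj₁ refl = a∈
    ... | inj₂ refl = b∈

  LabelledCorrespondence : LabelSet → Incidence → Incidence → List ℕ → List ℕ → (Label → ℕ) →
    List ℕ → List ℕ → (Label → ℕ) → Set
  LabelledCorrespondence B H H' VS ES α VS' ES' α' =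
    Σ (Correspondence H H' VS ES VS' ES') (λ C → ∀ u → u ∈s B → Correspondence.vmap C (α u) ≡ α' u)

  module _ {H H' : Incidence} where

    private
      ⇔I-resp : ∀ {P : Set} {a a' b b'} → a ≡ a' → b ≡ b' →
        (P → (a' , b') ∈I H') × ((a' , b') ∈I H' → P) → (P → (a , b) ∈I H') × ((a , b) ∈I H' → P)
      ⇔I-resp refl refl p = p

    correspond-introVertex : ∀ {B u} {u∉ : u ∉s B} {σ : ITD k B} {VS ES α VS' ES' α' w w' β β'} →
      Realises H σ VS ES α → Realises H' σ VS' ES' α' → ¬ (w ∈ℕ VS) → ¬ (w' ∈ℕ VS') →
      (∀ x → β x ≡ update α u w x) → (∀ x → β' x ≡ update α' u w' x) →
      LabelledCorrespondence B H H' VS ES α VS' ES' α' →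
      LabelledCorrespondence (B ∪ ⁅ u ⁆) H H' (w ∷ VS) ES β (w' ∷ VS') ES' β'
    correspond-introVertex {B} {u} {u∉} {VS = VS} {ES} {α} {VS'} {ES'} {α'} {w} {w'} {β} {β'}
      r r' w∉ w'∉ β≡ β'≡ (C , vmap-α) = C' , vmap-β
      where
      open Correspondence C
      vmap' : ℕ → ℕ
      vmap' = update vmap w w'
      old : ∀ {v} → v ∈ℕ VS → vmap' v ≡ vmap v
      old v∈ = update-other vmap w w' _ (∈⇒≢ v∈ w∉)
      incidence' : ∀ e v → e ∈ℕ ES → v ∈ℕ (w ∷ VS) →
        ((e , v) ∈I H → (emap e , vmap' v) ∈I H') × ((emap e , vmap' v) ∈I H' → (e , v) ∈I H)
      incidence' e v e∈ (here refl) =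
        (λ inc → ⊥-elim (w∉ (incident∈ (edge-within r e e∈) inc))) ,
        (λ inc → ⊥-elim (w'∉ (incident∈ (edge-within r' (emap e) (into ebij e e∈))
                                         (subst (λ z → (emap e , z) ∈I H') (update-same vmap w w') inc))))
      incidence' e v e∈ (there v∈) = ⇔I-resp refl (old v∈) (incidence e v e∈ v∈)
      C' : Correspondence H H' (w ∷ VS) ES (w' ∷ VS') ES'
      C' = record { vmap = vmap' ; emap = emap ; vbij = bijectionOn-∷ vbij w∉ w'∉ ; ebij = ebij ; incidence = incidence' }
      vmap-β : ∀ x → x ∈s (B ∪ ⁅ u ⁆) → vmap' (β x) ≡ β' x
      vmap-β x x∈ with x∈p∪⁅y⁆⁻ x∈
      ... | inj₁ x∈B =
        let x≢u : x ≢ u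
            x≢u = λ { refl → u∉ x∈B }
        in begin
          vmap' (β x)             ≡⟨ cong vmap' (trans (β≡ x) (update-other α u w x x≢u)) ⟩
          vmap' (α x)             ≡⟨ old (active∈ r x x∈B) ⟩
          vmap (α x)              ≡⟨ vmap-α x x∈B ⟩
          α' x                    ≡⟨ sym (trans (β'≡ x) (update-other α' u w' x x≢u)) ⟩
          β' x                    ∎
      ... | inj₂ refl = trans (cong vmap' (trans (β≡ x) (update-same α x w)))
                              (trans (update-same vmap w w') (sym (trans (β'≡ x) (update-same α' x w'))))

    correspond-introEdge : ∀ {B u v} {σ : ITD k B} {VS ES α VS' ES' α' e₀ e₀' β β'} →
      Realises H σ VS ES α → Realises H' σ VS' ES' α' → u ∈s B → v ∈s B → ¬ (e₀ ∈ℕ ES) → ¬ (e₀' ∈ℕ ES') →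
      Ends H e₀ (α u) (α v) → Ends H' e₀' (α' u) (α' v) →
      (∀ x → β x ≡ α x) → (∀ x → β' x ≡ α' x) →
      LabelledCorrespondence B H H' VS ES α VS' ES' α' →
      LabelledCorrespondence B H H' VS (e₀ ∷ ES) β VS' (e₀' ∷ ES') β'
    correspond-introEdge {B} {u} {v} {VS = VS} {ES} {α} {VS'} {ES'} {α'} {e₀} {e₀'} {β} {β'}
      r r' u∈ v∈ e₀∉ e₀'∉ ends ends' β≡ β'≡ (C , vmap-α) = C' , vmap-β
      where
      open Correspondence C
      emap' : ℕ → ℕ
      emap' = update emap e₀ e₀'
      toEnds : ∀ y → y ≡ α u ⊎ y ≡ α v → vmap y ≡ α' u ⊎ vmap y ≡ α' v
      toEnds y (inj₁ refl) = inj₁ (vmap-α u u∈)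
      toEnds y (inj₂ refl) = inj₂ (vmap-α v v∈)
      fromEnds : ∀ y → y ∈ℕ VS → vmap y ≡ α' u ⊎ vmap y ≡ α' v → y ≡ α u ⊎ y ≡ α v
      fromEnds y y∈ (inj₁ eq) = inj₁ (inj vbij y (α u) y∈ (active∈ r u u∈) (trans eq (sym (vmap-α u u∈))))
      fromEnds y y∈ (inj₂ eq) = inj₂ (inj vbij y (α v) y∈ (active∈ r v v∈) (trans eq (sym (vmap-α v v∈))))
      incidence' : ∀ e y → e ∈ℕ (e₀ ∷ ES) → y ∈ℕ VS →
        ((e , y) ∈I H → (emap' e , vmap y) ∈I H') × ((emap' e , vmap y) ∈I H' → (e , y) ∈I H)
      incidence' e y (here refl) y∈ = ⇔I-resp (update-same emap e e₀') refl
        ((λ inc → proj₂ (ends' (vmap y)) (toEnds y (proj₁ (ends y) inc))) ,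
         (λ inc → proj₂ (ends y) (fromEnds y y∈ (proj₁ (ends' (vmap y)) inc))))
      incidence' e y (there e∈) y∈ = ⇔I-resp (update-other emap e₀ e₀' e (∈⇒≢ e∈ e₀∉)) refl (incidence e y e∈ y∈)
      C' : Correspondence H H' VS (e₀ ∷ ES) VS' (e₀' ∷ ES')
      C' = record { vmap = vmap ; emap = emap' ; vbij = vbij ; ebij = bijectionOn-∷ ebij e₀∉ e₀'∉ ; incidence = incidence' }
      vmap-β : ∀ x → x ∈s B → vmap (β x) ≡ β' x
      vmap-β x x∈ = trans (cong vmap (β≡ x)) (trans (vmap-α x x∈) (sym (β'≡ x)))

    -- The two halves of a Join only share active vertices, on which both
    -- correspondences agree; this is what makes the glued maps bijective.
    correspond-join : ∀ {B} {σ₁ σ₂ : ITD k B} {VS₁ ES₁ α₁ VS₂ ES₂ α₂ VS₁' ES₁' α₁' VS₂' ES₂' α₂' β β'} →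
      Realises H σ₁ VS₁ ES₁ α₁ → Realises H σ₂ VS₂ ES₂ α₂ → Realises H' σ₁ VS₁' ES₁' α₁' → Realises H' σ₂ VS₂' ES₂' α₂' →
      (∀ u → u ∈s B → α₂ u ≡ α₁ u) → (∀ x → x ∈ℕ VS₁ → x ∈ℕ VS₂ → ∃[ u ] (u ∈s B × x ≡ α₁ u)) →
      (∀ e → e ∈ℕ ES₁ → ¬ (e ∈ℕ ES₂)) →
      (∀ u → u ∈s B → α₂' u ≡ α₁' u) → (∀ x → x ∈ℕ VS₁' → x ∈ℕ VS₂' → ∃[ u ] (u ∈s B × x ≡ α₁' u)) →
      (∀ e → e ∈ℕ ES₁' → ¬ (e ∈ℕ ES₂')) →
      (∀ x → β x ≡ α₁ x) → (∀ x → β' x ≡ α₁' x) →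
      LabelledCorrespondence B H H' VS₁ ES₁ α₁ VS₁' ES₁' α₁' → LabelledCorrespondence B H H' VS₂ ES₂ α₂ VS₂' ES₂' α₂' →
      LabelledCorrespondence B H H' (VS₁ ++ VS₂) (ES₁ ++ ES₂) β (VS₁' ++ VS₂') (ES₁' ++ ES₂') β'
    correspond-join {B} {VS₁ = VS₁} {ES₁} {α₁} {VS₂} {ES₂} {α₂} {VS₁'} {ES₁'} {α₁'} {VS₂'} {ES₂'} {α₂'} {β} {β'}
      r₁ r₂ r₁' r₂' agree shared disjoint agree' shared' disjoint' β≡ β'≡ (C₁ , vmap₁-α) (C₂ , vmap₂-α) = C , vmap-β
      where
      open Correspondence C₁ renaming (vmap to f₁; emap to g₁; vbij to vbij₁; ebij to ebij₁; incidence to incidence₁)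
      open Correspondence C₂ renaming (vmap to f₂; emap to g₂; vbij to vbij₂; ebij to ebij₂; incidence to incidence₂)
      back₁ : ∀ x → x ∈ℕ VS₁ → f₁ x ∈ℕ VS₂' → x ∈ℕ VS₂
      back₁ x x∈ fx∈ with shared' (f₁ x) (into vbij₁ x x∈) fx∈
      ... | u , u∈ , eq = subst (_∈ℕ VS₂)
        (trans (agree u u∈) (sym (inj vbij₁ x (α₁ u) x∈ (active∈ r₁ u u∈) (trans eq (sym (vmap₁-α u u∈))))))
        (active∈ r₂ u u∈)
      back₂ : ∀ x → x ∈ℕ VS₂ → f₂ x ∈ℕ VS₁' → x ∈ℕ VS₁
      back₂ x x∈ fx∈ with shared' (f₂ x) fx∈ (into vbij₂ x x∈)
      ... | u , u∈ , eq = subst (_∈ℕ VS₁)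
        (trans (sym (agree u u∈)) (sym (inj vbij₂ x (α₂ u) x∈ (active∈ r₂ u u∈)
                                          (trans eq (trans (sym (agree' u u∈)) (sym (vmap₂-α u u∈)))))))
        (active∈ r₁ u u∈)
      agreeV : ∀ x → x ∈ℕ VS₁ → x ∈ℕ VS₂ → f₁ x ≡ f₂ x
      agreeV x x∈₁ x∈₂ with shared x x∈₁ x∈₂
      ... | u , u∈ , refl = trans (vmap₁-α u u∈) (trans (sym (agree' u u∈)) (trans (sym (vmap₂-α u u∈)) (cong f₂ (agree u u∈))))
      crossV : ∀ x y → x ∈ℕ VS₁ → y ∈ℕ VS₂ → f₁ x ≡ f₂ y → x ≡ y
      crossV x y x∈ y∈ eq =
        let y∈₁ = back₂ y y∈ (subst (_∈ℕ VS₁') eq (into vbij₁ x x∈))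
        in inj vbij₁ x y x∈ y∈₁ (trans eq (sym (agreeV y y∈₁ y∈)))
      agreeE : ∀ e → e ∈ℕ ES₁ → e ∈ℕ ES₂ → g₁ e ≡ g₂ e
      agreeE e e∈₁ e∈₂ = ⊥-elim (disjoint e e∈₁ e∈₂)
      crossE : ∀ e e' → e ∈ℕ ES₁ → e' ∈ℕ ES₂ → g₁ e ≡ g₂ e' → e ≡ e'
      crossE e e' e∈ e'∈ eq = ⊥-elim (disjoint' (g₁ e) (into ebij₁ e e∈) (subst (_∈ℕ ES₂') (sym eq) (into ebij₂ e' e'∈)))
      f g : ℕ → ℕ
      f = piecewise VS₁ f₁ f₂
      g = piecewise ES₁ g₁ g₂
      incidence' : ∀ e y → e ∈ℕ (ES₁ ++ ES₂) → y ∈ℕ (VS₁ ++ VS₂) →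
        ((e , y) ∈I H → (g e , f y) ∈I H') × ((g e , f y) ∈I H' → (e , y) ∈I H)
      incidence' e y e∈ y∈ = cases (e ∈ℕ? ES₁) (y ∈ℕ? VS₁) (y ∈ℕ? VS₂) (∈-++⁻ ES₁ e∈) (∈-++⁻ VS₁ y∈)
        where
        cases : Dec (e ∈ℕ ES₁) → Dec (y ∈ℕ VS₁) → Dec (y ∈ℕ VS₂) → e ∈ℕ ES₁ ⊎ e ∈ℕ ES₂ → y ∈ℕ VS₁ ⊎ y ∈ℕ VS₂ →
          ((e , y) ∈I H → (g e , f y) ∈I H') × ((g e , f y) ∈I H' → (e , y) ∈I H)
        cases (yes e∈₁) (yes y∈₁) _ _ _ =
          ⇔I-resp (piecewise-in ES₁ g₁ g₂ e∈₁) (piecewise-in VS₁ f₁ f₂ y∈₁) (incidence₁ e y e∈₁ y∈₁)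
        cases (yes e∈₁) (no y∉₁) _ _ (inj₂ y∈₂) = ⇔I-resp (piecewise-in ES₁ g₁ g₂ e∈₁) (piecewise-out VS₁ f₁ f₂ y∉₁)
          ((λ inc → ⊥-elim (y∉₁ (incident∈ (edge-within r₁ e e∈₁) inc))) ,
           (λ inc → ⊥-elim (y∉₁ (back₂ y y∈₂ (incident∈ (edge-within r₁' (g₁ e) (into ebij₁ e e∈₁)) inc)))))
        cases (no e∉₁) (no y∉₁) _ (inj₂ e∈₂) (inj₂ y∈₂) =
          ⇔I-resp (piecewise-out ES₁ g₁ g₂ e∉₁) (piecewise-out VS₁ f₁ f₂ y∉₁) (incidence₂ e y e∈₂ y∈₂)
        cases (no e∉₁) (yes y∈₁) (yes y∈₂) (inj₂ e∈₂) _ =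
          ⇔I-resp (piecewise-out ES₁ g₁ g₂ e∉₁) (trans (piecewise-in VS₁ f₁ f₂ y∈₁) (agreeV y y∈₁ y∈₂)) (incidence₂ e y e∈₂ y∈₂)
        cases (no e∉₁) (yes y∈₁) (no y∉₂) (inj₂ e∈₂) _ = ⇔I-resp (piecewise-out ES₁ g₁ g₂ e∉₁) (piecewise-in VS₁ f₁ f₂ y∈₁)
          ((λ inc → ⊥-elim (y∉₂ (incident∈ (edge-within r₂ e e∈₂) inc))) ,
           (λ inc → ⊥-elim (y∉₂ (back₁ y y∈₁ (incident∈ (edge-within r₂' (g₂ e) (into ebij₂ e e∈₂)) inc)))))
        cases _ (no y∉₁) _ _ (inj₁ y∈₁) = ⊥-elim (y∉₁ y∈₁)
        cases (no e∉₁) _ _ (inj₁ e∈₁) _ = ⊥-elim (e∉₁ e∈₁)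
      C : Correspondence H H' (VS₁ ++ VS₂) (ES₁ ++ ES₂) (VS₁' ++ VS₂') (ES₁' ++ ES₂')
      C = record { vmap = f ; emap = g ; vbij = bijectionOn-++ vbij₁ vbij₂ agreeV crossV
                 ; ebij = bijectionOn-++ ebij₁ ebij₂ agreeE crossE ; incidence = incidence' }
      vmap-β : ∀ u → u ∈s B → f (β u) ≡ β' u
      vmap-β u u∈ = trans (cong f (β≡ u)) (trans (piecewise-in VS₁ f₁ f₂ (active∈ r₁ u u∈)) (trans (vmap₁-α u u∈) (sym (β'≡ u))))

    realisations-correspond : ∀ {B} {τ : ITD k B} {VS ES α VS' ES' α'} →
      Realises H τ VS ES α → Realises H' τ VS' ES' α' → LabelledCorrespondence B H H' VS ES α VS' ES' α'
    realisations-correspond leaf leaf =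
      record { vmap = λ x → x ; emap = λ x → x ; vbij = bijectionOn-[] ; ebij = bijectionOn-[] ; incidence = λ _ _ () } ,
      λ u u∈ → ⊥-elim (Subset.∉⊥ u∈)
    realisations-correspond (introVertex {u∉ = u∉} r w∉ α≡) (introVertex r' w'∉ α'≡) =
      correspond-introVertex {u∉ = u∉} r r' w∉ w'∉ α≡ α'≡ (realisations-correspond r r')
    realisations-correspond (forgetVertex r α≡) (forgetVertex r' α'≡) with realisations-correspond r r'
    ... | C , vmap-α = C , λ u u∈ → trans (cong (Correspondence.vmap C) (α≡ u))
                                         (trans (vmap-α u (proj₁ (x∈p-y⇒x∈p×x≢y u∈))) (sym (α'≡ u)))
    realisations-correspond (introEdge {u∈ = u∈} {v∈} r e∉ ends α≡) (introEdge r' e'∉ ends' α'≡) =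
      correspond-introEdge r r' u∈ v∈ e∉ e'∉ ends ends' α≡ α'≡ (realisations-correspond r r')
    realisations-correspond (join r₁ r₂ agree shared disjoint α≡) (join r₁' r₂' agree' shared' disjoint' α'≡) =
      correspond-join r₁ r₂ r₁' r₂' agree shared disjoint agree' shared' disjoint' α≡ α'≡
        (realisations-correspond r₁ r₁') (realisations-correspond r₂ r₂')

  Realises-rename : ∀ {H H' B} {σ : ITD k B} {VS ES α} (φ ψ : ℕ → ℕ) → Realises H σ VS ES α →
    (∀ x y → x ∈ℕ VS → y ∈ℕ VS → φ x ≡ φ y → x ≡ y) →
    (∀ x y → x ∈ℕ ES → y ∈ℕ ES → ψ x ≡ ψ y → x ≡ y) →
    (∀ e a b → e ∈ℕ ES → Ends H e a b → Ends H' (ψ e) (φ a) (φ b)) →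
    Realises H' σ (map φ VS) (map ψ ES) (λ x → φ (α x))
  Realises-rename φ ψ leaf _ _ _ = leaf
  Realises-rename φ ψ (introVertex {u = u} {α = α} {w = w} r w∉ α'≡) φ-inj ψ-inj ends =
    introVertex (Realises-rename φ ψ r (λ x y x∈ y∈ → φ-inj x y (there x∈) (there y∈)) ψ-inj ends)
      (λ φw∈ → let (y , y∈ , eq) = ∈-map⁻ φ φw∈ in w∉ (subst (_∈ℕ _) (sym (φ-inj w y (here refl) (there y∈) eq)) y∈))
      (λ x → trans (cong φ (α'≡ x)) (update-∘ φ α u w x))
  Realises-rename φ ψ (forgetVertex r α'≡) φ-inj ψ-inj ends =
    forgetVertex (Realises-rename φ ψ r φ-inj ψ-inj ends) (λ x → cong φ (α'≡ x))
  Realises-rename φ ψ (introEdge {e = e₀} r e∉ ends₀ α'≡) φ-inj ψ-inj ends =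
    introEdge (Realises-rename φ ψ r φ-inj (λ x y x∈ y∈ → ψ-inj x y (there x∈) (there y∈)) (λ e a b e∈ → ends e a b (there e∈)))
      (λ ψe∈ → let (y , y∈ , eq) = ∈-map⁻ ψ ψe∈ in e∉ (subst (_∈ℕ _) (sym (ψ-inj e₀ y (here refl) (there y∈) eq)) y∈))
      (ends e₀ _ _ (here refl) ends₀)
      (λ x → cong φ (α'≡ x))
  Realises-rename {H' = H'} φ ψ (join {B} {σ₁} {σ₂} {VS₁} {ES₁} {α₁} {VS₂} {ES₂} {α₂} {α'} r₁ r₂ agree shared disjoint α'≡)
    φ-inj ψ-inj ends =
    subst₂ (λ V E → Realises H' (Join σ₁ σ₂) V E (λ x → φ (α' x))) (sym (List.map-++ φ VS₁ VS₂)) (sym (List.map-++ ψ ES₁ ES₂))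
      (join (Realises-rename φ ψ r₁ (λ x y x∈ y∈ → φ-inj x y (∈-++⁺ˡ x∈) (∈-++⁺ˡ y∈))
                                    (λ x y x∈ y∈ → ψ-inj x y (∈-++⁺ˡ x∈) (∈-++⁺ˡ y∈)) (λ e a b e∈ → ends e a b (∈-++⁺ˡ e∈)))
            (Realises-rename φ ψ r₂ (λ x y x∈ y∈ → φ-inj x y (∈-++⁺ʳ VS₁ x∈) (∈-++⁺ʳ VS₁ y∈))
                                    (λ x y x∈ y∈ → ψ-inj x y (∈-++⁺ʳ ES₁ x∈) (∈-++⁺ʳ ES₁ y∈)) (λ e a b e∈ → ends e a b (∈-++⁺ʳ ES₁ e∈)))
            (λ u u∈ → cong φ (agree u u∈)) shared' disjoint' (λ x → cong φ (α'≡ x)))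
    where
    shared' : ∀ x → x ∈ℕ map φ VS₁ → x ∈ℕ map φ VS₂ → ∃[ u ] (u ∈s B × x ≡ φ (α₁ u))
    shared' x x∈₁ x∈₂ with ∈-map⁻ φ x∈₁ | ∈-map⁻ φ x∈₂
    ... | y₁ , y₁∈ , refl | y₂ , y₂∈ , eq with φ-inj y₁ y₂ (∈-++⁺ˡ y₁∈) (∈-++⁺ʳ VS₁ y₂∈) eq
    ... | refl with shared y₁ y₁∈ y₂∈
    ... | u , u∈ , refl = u , u∈ , refl
    disjoint' : ∀ x → x ∈ℕ map ψ ES₁ → ¬ (x ∈ℕ map ψ ES₂)
    disjoint' x x∈₁ x∈₂ with ∈-map⁻ ψ x∈₁ | ∈-map⁻ ψ x∈₂
    ... | y₁ , y₁∈ , refl | y₂ , y₂∈ , eq with ψ-inj y₁ y₂ (∈-++⁺ˡ y₁∈) (∈-++⁺ʳ ES₁ y₂∈) eq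
    ... | refl = disjoint y₁ y₁∈ y₂∈

  Realises-extend : ∀ {H H' B} {σ : ITD k B} {VS ES α} → Realises H σ VS ES α →
    (∀ e a b → e ∈ℕ ES → Ends H e a b → Ends H' e a b) → Realises H' σ VS ES α
  Realises-extend {H' = H'} {σ = σ} {VS} {ES} {α} r ends =
    subst₂ (λ V E → Realises H' σ V E α) (List.map-id VS) (List.map-id ES)
      (Realises-rename (λ x → x) (λ x → x) r (λ _ _ _ _ eq → eq) (λ _ _ _ _ eq → eq) ends)

  Fresh : LabelSet → (Label → ℕ) → ℕ → Set
  Fresh B ι x = findLabel B ι x (allFin (suc k)) ≡ nothing

  module _ {B : LabelSet} {ι : Label → ℕ} {x : ℕ} where

    findLabel-just : ∀ {u} (us : List Label) → findLabel B ι x us ≡ just u → u ∈s B × ι u ≡ x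
    findLabel-just (v ∷ us) eq with v Subset.∈? B | ι v ℕ.≟ x
    ... | yes v∈ | yes ιv≡ with eq
    ...   | refl = v∈ , ιv≡
    findLabel-just (v ∷ us) eq | yes _ | no _ = findLabel-just us eq
    findLabel-just (v ∷ us) eq | no _ | _ = findLabel-just us eq

    findLabel-nothing : ∀ (us : List Label) → findLabel B ι x us ≡ nothing → ∀ u → u ∈ us → u ∈s B → ι u ≢ x
    findLabel-nothing (v ∷ us) eq u u∈us u∈B ιu≡ with v Subset.∈? B | ι v ℕ.≟ x
    findLabel-nothing (v ∷ us) () u u∈us u∈B ιu≡ | yes _ | yes _
    findLabel-nothing (v ∷ us) eq u (here refl) u∈B ιu≡ | yes _ | no ιv≢ = ιv≢ ιu≡
    findLabel-nothing (v ∷ us) eq u (there u∈us) u∈B ιu≡ | yes _ | no _ = findLabel-nothing us eq u u∈us u∈B ιu≡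
    findLabel-nothing (v ∷ us) eq u (here refl) u∈B ιu≡ | no v∉ | _ = v∉ u∈B
    findLabel-nothing (v ∷ us) eq u (there u∈us) u∈B ιu≡ | no _ | _ = findLabel-nothing us eq u u∈us u∈B ιu≡

    Fresh⇒≢ : Fresh B ι x → ∀ u → u ∈s B → ι u ≢ x
    Fresh⇒≢ fresh u = findLabel-nothing (allFin (suc k)) fresh u (∈-allFin u)

    fresh? : Fresh B ι x ⊎ ∃[ u ] (findLabel B ι x (allFin (suc k)) ≡ just u)
    fresh? with findLabel B ι x (allFin (suc k))
    ... | just u = inj₂ (u , refl)
    ... | nothing = inj₁ refl

  module _ (B : LabelSet) (ι : Label → ℕ) where

    countFresh-fresh : ∀ {x} → Fresh B ι (suc x) → countFresh B ι (suc x) ≡ suc (countFresh B ι x)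
    countFresh-fresh fresh rewrite fresh = refl

    countFresh-old : ∀ {x u} → findLabel B ι (suc x) (allFin (suc k)) ≡ just u → countFresh B ι (suc x) ≡ countFresh B ι x
    countFresh-old eq rewrite eq = refl

    countFresh-mono : ∀ {x y} → x ≤ y → countFresh B ι x ≤ countFresh B ι y
    countFresh-mono {y = zero} z≤n = ℕ.≤-refl
    countFresh-mono {y = suc y} x≤ with ℕ.m≤n⇒m<n∨m≡n x≤
    ... | inj₂ refl = ℕ.≤-refl
    ... | inj₁ (s≤s x≤y) = ℕ.≤-trans (countFresh-mono x≤y) countFresh-step
      where
      countFresh-step : countFresh B ι y ≤ countFresh B ι (suc y)
      countFresh-step with findLabel B ι (suc y) (allFin (suc k))
      ... | just _ = ℕ.≤-refl
      ... | nothing = ℕ.n≤1+n _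

    countFresh-strict : ∀ {x y} → x < y → Fresh B ι y → countFresh B ι x < countFresh B ι y
    countFresh-strict {y = suc y} (s≤s x≤y) fresh rewrite countFresh-fresh fresh = s≤s (countFresh-mono x≤y)

    countFresh-positive : ∀ {x} → 1 ≤ x → Fresh B ι x → 1 ≤ countFresh B ι x
    countFresh-positive {suc x} _ fresh rewrite countFresh-fresh fresh = s≤s z≤n

    countFresh-onto : ∀ n j → 1 ≤ j → j ≤ countFresh B ι n →
      ∃[ x ] (1 ≤ x × x ≤ n × Fresh B ι x × countFresh B ι x ≡ j)
    countFresh-onto zero j 1≤j j≤ = ⊥-elim (ℕ.<-irrefl refl (ℕ.≤-trans 1≤j j≤))
    countFresh-onto (suc n) j 1≤j j≤ with fresh? {B} {ι} {suc n}
    ... | inj₂ (u , eq) =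
      let (x , 1≤x , x≤n , fresh , count) = countFresh-onto n j 1≤j (subst (j ≤_) (countFresh-old eq) j≤)
      in x , 1≤x , ℕ.m≤n⇒m≤1+n x≤n , fresh , count
    ... | inj₁ fresh with ℕ.m≤n⇒m<n∨m≡n (subst (j ≤_) (countFresh-fresh fresh) j≤)
    ...   | inj₂ refl = suc n , s≤s z≤n , ℕ.≤-refl , fresh , countFresh-fresh fresh
    ...   | inj₁ (s≤s j≤′) =
      let (x , 1≤x , x≤n , fresh′ , count) = countFresh-onto n j 1≤j j≤′
      in x , 1≤x , ℕ.m≤n⇒m≤1+n x≤n , fresh′ , count

  joinRenaming : LabelSet → ℕ → (Label → ℕ) → (Label → ℕ) → ℕ → ℕ
  joinRenaming B n₁ ι₁ ι₂ x with findLabel B ι₂ x (allFin (suc k))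
  ... | just u = ι₁ u
  ... | nothing = n₁ + countFresh B ι₂ x

  module JoinRenaming (B : LabelSet) (n₁ : ℕ) (ι₁ : Label → ℕ) (n₂ : ℕ) (ι₂ : Label → ℕ)
    (ι₁-into : ∀ u → u ∈s B → ι₁ u ∈ℕ oneTo n₁)
    (ι₁-inj : ∀ u v → u ∈s B → v ∈s B → ι₁ u ≡ ι₁ v → u ≡ v)
    (ι₂-inj : ∀ u v → u ∈s B → v ∈s B → ι₂ u ≡ ι₂ v → u ≡ v) where

    h : ℕ → ℕ
    h = joinRenaming B n₁ ι₁ ι₂

    h-active : ∀ {x u} → findLabel B ι₂ x (allFin (suc k)) ≡ just u → h x ≡ ι₁ u
    h-active eq rewrite eq = refl

    h-fresh : ∀ {x} → Fresh B ι₂ x → h x ≡ n₁ + countFresh B ι₂ x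
    h-fresh eq rewrite eq = refl

    h-agrees : ∀ u → u ∈s B → h (ι₂ u) ≡ ι₁ u
    h-agrees u u∈ with fresh? {B} {ι₂} {ι₂ u}
    ... | inj₁ fresh = ⊥-elim (Fresh⇒≢ fresh u u∈ refl)
    ... | inj₂ (u' , eq) = let (u'∈ , ι₂u'≡) = findLabel-just (allFin (suc k)) eq in
      trans (h-active eq) (cong ι₁ (ι₂-inj u' u u'∈ u∈ ι₂u'≡))

    n₁<h-fresh : ∀ x → 1 ≤ x → Fresh B ι₂ x → n₁ < h x
    n₁<h-fresh x 1≤x fresh rewrite h-fresh fresh =
      subst (_< n₁ + countFresh B ι₂ x) (ℕ.+-identityʳ n₁) (ℕ.+-monoʳ-< n₁ (countFresh-positive B ι₂ 1≤x fresh))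

    h-injective : ∀ x y → x ∈ℕ oneTo n₂ → y ∈ℕ oneTo n₂ → h x ≡ h y → x ≡ y
    h-injective x y x∈ y∈ eq with fresh? {B} {ι₂} {x} | fresh? {B} {ι₂} {y}
    ... | inj₂ (u , eqx) | inj₂ (v , eqy) =
      let (u∈ , ι₂u≡) = findLabel-just (allFin (suc k)) eqx ; (v∈ , ι₂v≡) = findLabel-just (allFin (suc k)) eqy in
      trans (sym ι₂u≡) (trans (cong ι₂ (ι₁-inj u v u∈ v∈ (trans (sym (h-active eqx)) (trans eq (h-active eqy))))) ι₂v≡)
    ... | inj₂ (u , eqx) | inj₁ fy =
      ⊥-elim (ℕ.<⇒≱ (n₁<h-fresh y (oneTo-positive y∈) fy)
                    (subst (_≤ n₁) (trans (sym (h-active eqx)) eq) (oneTo-bounded (ι₁-into u (proj₁ (findLabel-just (allFin (suc k)) eqx))))))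
    ... | inj₁ fx | inj₂ (v , eqy) =
      ⊥-elim (ℕ.<⇒≱ (n₁<h-fresh x (oneTo-positive x∈) fx)
                    (subst (_≤ n₁) (trans (sym (h-active eqy)) (sym eq)) (oneTo-bounded (ι₁-into v (proj₁ (findLabel-just (allFin (suc k)) eqy))))))
    ... | inj₁ fx | inj₁ fy with ℕ.<-cmp x y
    ...   | tri≈ _ x≡y _ = x≡y
    ...   | tri< x<y _ _ = ⊥-elim (ℕ.<-irrefl (ℕ.+-cancelˡ-≡ n₁ _ _ (trans (sym (h-fresh fx)) (trans eq (h-fresh fy))))
                                               (countFresh-strict B ι₂ x<y fy))
    ...   | tri> _ _ y<x = ⊥-elim (ℕ.<-irrefl (ℕ.+-cancelˡ-≡ n₁ _ _ (trans (sym (h-fresh fy)) (trans (sym eq) (h-fresh fx))))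
                                               (countFresh-strict B ι₂ y<x fx))

    h-shared : ∀ x y → x ∈ℕ oneTo n₁ → y ∈ℕ oneTo n₂ → x ≡ h y → ∃[ u ] (u ∈s B × x ≡ ι₁ u)
    h-shared x y x∈ y∈ x≡ with fresh? {B} {ι₂} {y}
    ... | inj₂ (u , eqy) = u , proj₁ (findLabel-just (allFin (suc k)) eqy) , trans x≡ (h-active eqy)
    ... | inj₁ fy = ⊥-elim (ℕ.<⇒≱ (n₁<h-fresh y (oneTo-positive y∈) fy) (subst (_≤ n₁) x≡ (oneTo-bounded x∈)))

    private
      N : ℕ
      N = n₁ + countFresh B ι₂ n₂

      h-into : ∀ y → y ∈ℕ oneTo n₂ → h y ∈ℕ oneTo N
      h-into y y∈ with fresh? {B} {ι₂} {y}
      ... | inj₂ (u , eqy) =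
        let ι₁u∈ = ι₁-into u (proj₁ (findLabel-just (allFin (suc k)) eqy)) in
        subst (_∈ℕ oneTo N) (sym (h-active eqy)) (oneTo-mono (ℕ.m≤m+n n₁ _) ι₁u∈)
      ... | inj₁ fy = ∈-oneTo⁺ (ℕ.≤-trans (s≤s z≤n) (n₁<h-fresh y (oneTo-positive y∈) fy))
                               (subst (_≤ N) (sym (h-fresh fy)) (ℕ.+-monoʳ-≤ n₁ (countFresh-mono B ι₂ (oneTo-bounded y∈))))

      h-covers : ∀ x → x ∈ℕ oneTo N → x ∈ℕ oneTo n₁ ⊎ ∃[ y ] (y ∈ℕ oneTo n₂ × h y ≡ x)
      h-covers x x∈ with ℕ.≤-<-connex x n₁
      ... | inj₁ x≤n₁ = inj₁ (∈-oneTo⁺ (oneTo-positive x∈) x≤n₁)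
      ... | inj₂ n₁<x =
        let x≡ : x ≡ n₁ + (x ∸ n₁)
            x≡ = sym (ℕ.m+[n∸m]≡n (ℕ.<⇒≤ n₁<x))
            (y , 1≤y , y≤n₂ , fresh , count) = countFresh-onto B ι₂ n₂ (x ∸ n₁) (ℕ.m<n⇒0<n∸m n₁<x)
              (ℕ.+-cancelˡ-≤ n₁ _ _ (subst (_≤ N) x≡ (oneTo-bounded x∈)))
        in inj₂ (y , ∈-oneTo⁺ 1≤y y≤n₂ , trans (h-fresh fresh) (trans (cong (n₁ +_) count) (sym x≡)))

    h-≐ : (oneTo n₁ ++ map h (oneTo n₂)) ≐ oneTo N
    h-≐ x = to , from
      where
      to : x ∈ℕ (oneTo n₁ ++ map h (oneTo n₂)) → x ∈ℕ oneTo N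
      to x∈ with ∈-++⁻ (oneTo n₁) x∈
      ... | inj₁ x∈₁ = oneTo-mono (ℕ.m≤m+n n₁ _) x∈₁
      ... | inj₂ x∈₂ with ∈-map⁻ h x∈₂
      ...   | y , y∈ , refl = h-into y y∈
      from : x ∈ℕ oneTo N → x ∈ℕ (oneTo n₁ ++ map h (oneTo n₂))
      from x∈ with h-covers x x∈
      ... | inj₁ x∈₁ = ∈-++⁺ˡ x∈₁
      ... | inj₂ (y , y∈ , refl) = ∈-++⁺ʳ (oneTo n₁) (∈-map⁺ h y∈)

  open Built

  RealisesWith : ∀ {B} → ITD k B → List (ℕ × ℕ) → ℕ → (Label → ℕ) → Set
  RealisesWith τ es n ι = ∃[ VS ] ∃[ ES ] (Realises (incidences 0 es) τ VS ES ι × VS ≐ oneTo n × ES ≐ oneTo (length es))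

  GraphOfRealises : ∀ {B} → ITD k B → Set
  GraphOfRealises τ = RealisesWith τ (edges (build τ)) (nV (build τ)) (ι (build τ))

  -- build names the vertex renaming of a Join only locally; abstracting over build
  -- recovers it as F, which then unfolds to joinRenaming.
  join-edges : ∀ {B} (σ₁ σ₂ : ITD k B) →
    let h = joinRenaming B (nV (build σ₁)) (ι (build σ₁)) (ι (build σ₂)) in
    edges (build (Join σ₁ σ₂)) ≡ edges (build σ₁) ++ map (λ p → h (proj₁ p) , h (proj₂ p)) (edges (build σ₂))
  join-edges {B} σ₁ σ₂ =
    trans (proj₂ build-Join-edges)
          (cong (edges (build σ₁) ++_) (List.map-cong (λ p → cong₂ _,_ (F≗h (proj₁ p)) (F≗h (proj₂ p))) (edges (build σ₂))))
    where
    build-Join-edges : Σ (ℕ × ℕ → ℕ × ℕ) (λ F → edges (build (Join σ₁ σ₂)) ≡ edges (build σ₁) ++ map F (edges (build σ₂)))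
    build-Join-edges with build σ₁ | build σ₂
    ... | built _ _ _ | built _ _ _ = _ , refl
    F≗h : ∀ x → proj₁ (proj₁ build-Join-edges (x , x)) ≡ joinRenaming B (nV (build σ₁)) (ι (build σ₁)) (ι (build σ₂)) x
    F≗h x with findLabel B (ι (build σ₂)) x (allFin _)
    ... | just _ = refl
    ... | nothing = refl

  private
    embed-++ˡ : ∀ (es es' : List (ℕ × ℕ)) {VS ES} {B} {σ : ITD k B} {α} →
      Realises (incidences 0 es) σ VS ES α → ES ≐ oneTo (length es) → Realises (incidences 0 (es ++ es')) σ VS ES α
    embed-++ˡ es es' r ES≐ = Realises-extend r λ e a b e∈ →
      incidences-ends-embed es (es ++ es') (λ x → x) 0 (λ _ _ at → []=-++ˡ at) e a b (proj₁ (ES≐ e) e∈)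

  graphOf-realises-introVertex : ∀ {B} u (u∉ : u ∉s B) (σ : ITD k B) → GraphOfRealises σ → GraphOfRealises (IntroVertex u u∉ σ)
  graphOf-realises-introVertex u u∉ σ (VS , ES , r , VS≐ , ES≐) =
    suc n ∷ VS , ES , introVertex r (λ n+1∈ → suc∉oneTo n (proj₁ (VS≐ _) n+1∈)) (λ _ → refl) ,
    ≐-trans (≐-∷ (suc n) VS≐) (oneTo-suc n) , ES≐
    where
    n : ℕ
    n = nV (build σ)

  graphOf-realises-introEdge : ∀ {B} u v (u≢v : u ≢ v) (u∈ : u ∈s B) (v∈ : v ∈s B) (σ : ITD k B) →
    GraphOfRealises σ → GraphOfRealises (IntroEdge u v u≢v u∈ v∈ σ)
  graphOf-realises-introEdge u v u≢v u∈ v∈ σ (VS , ES , r , VS≐ , ES≐) =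
    VS , suc (length es) ∷ ES , introEdge (embed-++ˡ es (p ∷ []) r ES≐) (λ e∈ → suc∉oneTo (length es) (proj₁ (ES≐ _) e∈))
                                          (incidences-ends at) (λ _ → refl) ,
    VS≐ , ≐-trans (≐-∷ _ ES≐) (subst (λ n → (suc (length es) ∷ oneTo (length es)) ≐ oneTo n) (sym length≡) (oneTo-suc (length es)))
    where
    es : List (ℕ × ℕ)
    es = edges (build σ)
    p : ℕ × ℕ
    p = (ι (build σ) u , ι (build σ) v)
    at : (es ++ p ∷ []) [ length es ]= p
    at = subst (λ j → (es ++ p ∷ []) [ j ]= p) (ℕ.+-identityʳ (length es)) ([]=-++ʳ es first)
    length≡ : length (es ++ p ∷ []) ≡ suc (length es)
    length≡ = trans (List.length-++ es) (ℕ.+-comm (length es) 1)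

  graphOf-realises-join : ∀ {B} (σ₁ σ₂ : ITD k B) → GraphOfRealises σ₁ → GraphOfRealises σ₂ → GraphOfRealises (Join σ₁ σ₂)
  graphOf-realises-join {B} σ₁ σ₂ (VS₁ , ES₁ , r₁ , VS₁≐ , ES₁≐) (VS₂ , ES₂ , r₂ , VS₂≐ , ES₂≐) =
    subst (λ L → RealisesWith (Join σ₁ σ₂) L (n₁ + countFresh B ι₂ n₂) ι₁) (sym (join-edges σ₁ σ₂))
      (VS₁ ++ map h VS₂ , ES₁ ++ map (o +_) ES₂ ,
       join r₁' r₂' (λ u u∈ → h-agrees u u∈) shared disjoint (λ _ → refl) ,
       ≐-trans (≐-++ VS₁≐ (≐-map h VS₂≐)) h-≐ ,
       ≐-trans (≐-++ ES₁≐ (≐-map (o +_) ES₂≐))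
             (subst (λ n → (oneTo o ++ map (o +_) (oneTo (length es₂))) ≐ oneTo n) (sym length≡) (oneTo-+ o (length es₂))))
    where
    n₁ n₂ : ℕ
    n₁ = nV (build σ₁)
    n₂ = nV (build σ₂)
    es₁ es₂ : List (ℕ × ℕ)
    es₁ = edges (build σ₁)
    es₂ = edges (build σ₂)
    o : ℕ
    o = length es₁
    ι₁ ι₂ : Label → ℕ
    ι₁ = ι (build σ₁)
    ι₂ = ι (build σ₂)
    open JoinRenaming B n₁ ι₁ n₂ ι₂ (λ u u∈ → proj₁ (VS₁≐ _) (active∈ r₁ u u∈)) (active-injective r₁) (active-injective r₂)
    es : List (ℕ × ℕ)
    es = es₁ ++ map (λ p → h (proj₁ p) , h (proj₂ p)) es₂
    length≡ : length es ≡ o + length es₂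
    length≡ = trans (List.length-++ es₁) (cong (o +_) (List.length-map _ es₂))
    r₁' : Realises (incidences 0 es) σ₁ VS₁ ES₁ ι₁
    r₁' = embed-++ˡ es₁ _ r₁ ES₁≐
    r₂' : Realises (incidences 0 es) σ₂ (map h VS₂) (map (o +_) ES₂) (λ x → h (ι₂ x))
    r₂' = Realises-rename h (o +_) r₂ (λ x y x∈ y∈ → h-injective x y (proj₁ (VS₂≐ x) x∈) (proj₁ (VS₂≐ y) y∈))
            (λ x y _ _ → ℕ.+-cancelˡ-≡ o x y)
            (λ e a b e∈ → incidences-ends-embed es₂ es h o (λ _ _ at → []=-++ʳ es₁ ([]=-map _ at)) e a b (proj₁ (ES₂≐ e) e∈))
    shared : ∀ x → x ∈ℕ VS₁ → x ∈ℕ map h VS₂ → ∃[ u ] (u ∈s B × x ≡ ι₁ u)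
    shared x x∈₁ x∈₂ with ∈-map⁻ h x∈₂
    ... | y , y∈ , x≡ = h-shared x y (proj₁ (VS₁≐ x) x∈₁) (proj₁ (VS₂≐ y) y∈) x≡
    disjoint : ∀ e → e ∈ℕ ES₁ → ¬ (e ∈ℕ map (o +_) ES₂)
    disjoint e e∈₁ e∈₂ with ∈-map⁻ (o +_) e∈₂
    ... | y , y∈ , refl = ℕ.<⇒≱ (ℕ.m<m+n o (oneTo-positive (proj₁ (ES₂≐ y) y∈))) (oneTo-bounded (proj₁ (ES₁≐ _) e∈₁))

  graphOf-realises : ∀ {B} (τ : ITD k B) → GraphOfRealises τ
  graphOf-realises Leaf = [] , [] , leaf , ≐-refl , ≐-refl
  graphOf-realises (IntroVertex u u∉ σ) = graphOf-realises-introVertex u u∉ σ (graphOf-realises σ)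
  graphOf-realises (ForgetVertex u u∈ σ) with graphOf-realises σ
  ... | VS , ES , r , VS≐ , ES≐ = VS , ES , forgetVertex r (λ _ → refl) , VS≐ , ES≐
  graphOf-realises (IntroEdge u v u≢v u∈ v∈ σ) = graphOf-realises-introEdge u v u≢v u∈ v∈ σ (graphOf-realises σ)
  graphOf-realises (Join σ₁ σ₂) = graphOf-realises-join σ₁ σ₂ (graphOf-realises σ₁) (graphOf-realises σ₂)

  -- Tree decompositions from realisations

  activeLabels : LabelSet → List Label
  activeLabels B = filter (_∈? B) (allFin (suc k))
    where open Subset using (_∈?_)

  ∈-activeLabels⁺ : ∀ {B u} → u ∈s B → u ∈ activeLabels B
  ∈-activeLabels⁺ {B} {u} u∈ = ∈-filter⁺ (Subset._∈? B) (∈-allFin u) u∈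

  ∈-activeLabels⁻ : ∀ {B u} → u ∈ activeLabels B → u ∈s B
  ∈-activeLabels⁻ {B} u∈ = proj₂ (∈-filter⁻ (Subset._∈? B) {xs = allFin (suc k)} u∈)

  activeBag : (Label → ℕ) → LabelSet → List ℕ
  activeBag α B = map α (activeLabels B)

  activeBag-properties : ∀ {H B} {τ : ITD k B} {VS ES α} → Realises H τ VS ES α →
    Unique (activeBag α B) × length (activeBag α B) ≤ suc k × (∀ v → v ∈ℕ activeBag α B → v ∈ℕ VS)
  activeBag-properties {B = B} {α = α} r =
    Unique-map-local α (Unique.filter⁺ (Subset._∈? B) (Unique.allFin⁺ (suc k)))
      (λ x y x∈ y∈ → active-injective r x y (∈-activeLabels⁻ x∈) (∈-activeLabels⁻ y∈)) ,
    subst (_≤ suc k) (sym (List.length-map α (activeLabels B)))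
      (ℕ.≤-trans (List.length-filter (Subset._∈? B) (allFin (suc k))) (ℕ.≤-reflexive (List.length-tabulate (λ i → i)))) ,
    λ v v∈ → let (x , x∈ , v≡) = ∈-map⁻ α v∈ in subst (_∈ℕ _) (sym v≡) (active∈ r x (∈-activeLabels⁻ x∈))

  record Decomposes (H : Incidence) (VS ES : List ℕ) (D : BagTree) : Set where
    field
      unique : ∀ t → Unique (bags D t)
      width≤ : ∀ t → length (bags D t) ≤ suc k
      within : ∀ t v → v ∈ℕ bags D t → v ∈ℕ VS
      covers-vertices : ∀ v → v ∈ℕ VS → ∃[ t ] (v ∈ℕ bags D t)
      covers-edges : ∀ e → e ∈ℕ ES → ∃[ t ] (∀ v → (e , v) ∈I H → v ∈ℕ bags D t)
  open Decomposes

  Decomposes-resp : ∀ {H VS VS' ES D} → VS ≐ VS' → Decomposes H VS ES D → Decomposes H VS' ES D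
  Decomposes-resp VS≐ dec = record
    { unique = unique dec ; width≤ = width≤ dec ; within = λ t v v∈ → proj₁ (VS≐ v) (within dec t v v∈)
    ; covers-vertices = λ v v∈ → covers-vertices dec v (proj₂ (VS≐ v) v∈) ; covers-edges = covers-edges dec }

  singleBag-decomposes : ∀ {H X} → Unique X → length X ≤ suc k → Decomposes H X [] (singleBag X)
  singleBag-decomposes uniq length≤ = record
    { unique = λ _ → uniq ; width≤ = λ _ → length≤ ; within = λ _ _ v∈ → v∈
    ; covers-vertices = λ _ v∈ → fzero , v∈ ; covers-edges = λ _ () }

  glue-decomposes : ∀ {H VS₁ ES₁ VS₂ ES₂ D₁ D₂} (shared : SharedInRoots D₁ D₂) →
    Decomposes H VS₁ ES₁ D₁ → Decomposes H VS₂ ES₂ D₂ → Decomposes H (VS₁ ++ VS₂) (ES₁ ++ ES₂) (glue D₁ D₂ shared)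
  glue-decomposes {H} {VS₁} {ES₁} {VS₂} {D₁ = D₁} {D₂} shared dec₁ dec₂ = record
    { unique = glue-all D₁ D₂ shared Unique (unique dec₁) (unique dec₂)
    ; width≤ = glue-all D₁ D₂ shared (λ L → length L ≤ suc k) (width≤ dec₁) (width≤ dec₂)
    ; within = glue-all D₁ D₂ shared (λ L → ∀ v → v ∈ℕ L → v ∈ℕ (VS₁ ++ VS₂))
                 (λ t v v∈ → ∈-++⁺ˡ (within dec₁ t v v∈)) (λ t v v∈ → ∈-++⁺ʳ VS₁ (within dec₂ t v v∈))
    ; covers-vertices = λ v v∈ → [ coveredˡ (v ∈ℕ_) (covers-vertices dec₁ v) , coveredʳ (v ∈ℕ_) (covers-vertices dec₂ v) ] (∈-++⁻ VS₁ v∈)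
    ; covers-edges = λ e e∈ → [ coveredˡ (EndsIn e) (covers-edges dec₁ e) , coveredʳ (EndsIn e) (covers-edges dec₂ e) ] (∈-++⁻ ES₁ e∈)
    }
    where
    EndsIn : ℕ → List ℕ → Set
    EndsIn e L = ∀ v → (e , v) ∈I H → v ∈ℕ L
    coveredˡ : ∀ {A : Set} (P : List ℕ → Set) → (A → ∃[ t ] P (bags D₁ t)) → A → ∃[ t ] P (bags (glue D₁ D₂ shared) t)
    coveredˡ P cover a = let (t , p) = cover a in glue-∃ˡ D₁ D₂ shared P t p
    coveredʳ : ∀ {A : Set} (P : List ℕ → Set) → (A → ∃[ t ] P (bags D₂ t)) → A → ∃[ t ] P (bags (glue D₁ D₂ shared) t)
    coveredʳ P cover a = let (t , p) = cover a in glue-∃ʳ D₁ D₂ shared P t p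

  RootDecomposition : Incidence → LabelSet → List ℕ → List ℕ → (Label → ℕ) → Set
  RootDecomposition H B VS ES α = Σ BagTree (λ D → Decomposes H VS ES D × (∀ u → u ∈s B → α u ∈ℕ bags D fzero))

  decompose-introVertex : ∀ {H B u} {u∉ : u ∉s B} {σ : ITD k B} {VS ES α α' w} →
    (r : Realises H σ VS ES α) (w∉ : ¬ (w ∈ℕ VS)) (α'≡ : ∀ x → α' x ≡ update α u w x) →
    RootDecomposition H B VS ES α → RootDecomposition H (B ∪ ⁅ u ⁆) (w ∷ VS) ES α'
  decompose-introVertex {H} {B} {u} {u∉} {VS = VS} {ES} {α} {α'} {w} r w∉ α'≡ (D , dec , root-active) =
    glue (singleBag root) D shared ,
    Decomposes-resp root++VS≐ (glue-decomposes shared (singleBag-decomposes root-unique root-width) dec) ,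
    λ x x∈ → ∈-map⁺ α' (∈-activeLabels⁺ x∈)
    where
    root : List ℕ
    root = activeBag α' (B ∪ ⁅ u ⁆)
    root-properties : Unique root × length root ≤ suc k × (∀ v → v ∈ℕ root → v ∈ℕ (w ∷ VS))
    root-properties = activeBag-properties (introVertex {u∉ = u∉} r w∉ α'≡)
    root-unique : Unique root
    root-unique = proj₁ root-properties
    root-width : length root ≤ suc k
    root-width = proj₁ (proj₂ root-properties)
    root⊆ : ∀ v → v ∈ℕ root → v ∈ℕ (w ∷ VS)
    root⊆ = proj₂ (proj₂ root-properties)
    w∈root : w ∈ℕ root
    w∈root = subst (_∈ℕ root) (trans (α'≡ u) (update-same α u w)) (∈-map⁺ α' (∈-activeLabels⁺ {B ∪ ⁅ u ⁆} (y∈p∪⁅y⁆ {p = B} u)))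
    root++VS≐ : (root ++ VS) ≐ (w ∷ VS)
    root++VS≐ v = (λ v∈ → [ root⊆ v , there ] (∈-++⁻ root v∈)) ,
                  (λ { (here refl) → ∈-++⁺ˡ w∈root ; (there v∈) → ∈-++⁺ʳ root v∈ })
    shared : SharedInRoots (singleBag root) D
    shared v _ t v∈root v∈t with ∈-map⁻ α' v∈root
    ... | x , x∈ , refl with x∈p∪⁅y⁆⁻ {p = B} (∈-activeLabels⁻ {B ∪ ⁅ u ⁆} x∈)
    ...   | inj₂ refl = ⊥-elim (w∉ (subst (_∈ℕ VS) (trans (α'≡ x) (update-same α x w)) (within dec t _ v∈t)))
    ...   | inj₁ x∈B = v∈root ,
      subst (_∈ℕ bags D fzero) (sym (trans (α'≡ x) (update-other α u w x λ { refl → u∉ x∈B }))) (root-active x x∈B)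

  decompose-join : ∀ {H B VS₁ ES₁ VS₂ ES₂} {α₁ α₂ α' : Label → ℕ} →
    (∀ u → u ∈s B → α₂ u ≡ α₁ u) → (∀ x → x ∈ℕ VS₁ → x ∈ℕ VS₂ → ∃[ u ] (u ∈s B × x ≡ α₁ u)) → (∀ x → α' x ≡ α₁ x) →
    RootDecomposition H B VS₁ ES₁ α₁ → RootDecomposition H B VS₂ ES₂ α₂ → RootDecomposition H B (VS₁ ++ VS₂) (ES₁ ++ ES₂) α'
  decompose-join agree shared α'≡ (D₁ , dec₁ , root-active₁) (D₂ , dec₂ , root-active₂) =
    glue D₁ D₂ shared' , glue-decomposes shared' dec₁ dec₂ ,
    λ x x∈ → subst (_∈ℕ bags D₁ fzero) (sym (α'≡ x)) (root-active₁ x x∈)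
    where
    shared' : SharedInRoots D₁ D₂
    shared' v s t v∈s v∈t with shared v (within dec₁ s v v∈s) (within dec₂ t v v∈t)
    ... | u , u∈ , refl = root-active₁ u u∈ , subst (_∈ℕ bags D₂ fzero) (agree u u∈) (root-active₂ u u∈)

  decompose : ∀ {H B} {τ : ITD k B} {VS ES α} → Realises H τ VS ES α → RootDecomposition H B VS ES α
  decompose leaf = singleBag [] , singleBag-decomposes [] z≤n , λ u u∈ → ⊥-elim (Subset.∉⊥ u∈)
  decompose (introVertex {u∉ = u∉} r w∉ α'≡) = decompose-introVertex {u∉ = u∉} r w∉ α'≡ (decompose r)
  decompose (forgetVertex r α'≡) with decompose r
  ... | D , dec , root-active =
    D , dec , λ x x∈ → subst (_∈ℕ bags D fzero) (sym (α'≡ x)) (root-active x (proj₁ (x∈p-y⇒x∈p×x≢y x∈)))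
  decompose {H} (introEdge {u = u} {v} {u∈ = u∈} {v∈} {VS = VS} {ES} {α} {e = e₀} r _ ends α'≡) with decompose r
  ... | D , dec , root-active = D , dec' , λ x x∈ → subst (_∈ℕ bags D fzero) (sym (α'≡ x)) (root-active x x∈)
    where
    endsInRoot : ∀ z → z ≡ α u ⊎ z ≡ α v → z ∈ℕ bags D fzero
    endsInRoot z (inj₁ refl) = root-active u u∈
    endsInRoot z (inj₂ refl) = root-active v v∈
    covers-edges' : ∀ e → e ∈ℕ (e₀ ∷ ES) → ∃[ t ] (∀ z → (e , z) ∈I H → z ∈ℕ bags D t)
    covers-edges' e (here refl) = fzero , λ z inc → endsInRoot z (proj₁ (ends z) inc)
    covers-edges' e (there e∈) = covers-edges dec e e∈
    dec' : Decomposes H VS (e₀ ∷ ES) D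
    dec' = record { unique = unique dec ; width≤ = width≤ dec ; within = within dec
                  ; covers-vertices = covers-vertices dec ; covers-edges = covers-edges' }
  decompose (join r₁ r₂ agree shared _ α'≡) = decompose-join agree shared α'≡ (decompose r₁) (decompose r₂)

  realisation⇒treewidth : ∀ (G : Graph) {B} {τ : ITD k B} {VS ES α} → Realises (I G) τ VS ES α →
    VS ≐ V G → ES ≐ E G → TreewidthAtMost G k
  realisation⇒treewidth G r VS≐ ES≐ with decompose r
  ... | D , dec , _ = record
    { tree = shape D ; bag = bags D ; bag-unique = unique dec
    ; bag-sub = λ t v v∈ → proj₁ (VS≐ v) (within dec t v v∈)
    ; cover-vertices = λ v v∈ → covers-vertices dec v (proj₂ (VS≐ v) v∈)
    ; cover-edges = λ e e∈ → covers-edges dec e (proj₂ (ES≐ e) e∈)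
    ; connected = bags-connected D } , width≤ dec

  instructive⇒treewidth : ∀ (G : Graph) → IsGraph G → ∀ {B} (τ : ITD k B) → graphOf τ ≃ G → TreewidthAtMost G k
  instructive⇒treewidth G isGraph τ iso with graphOf-realises τ
  ... | VS , ES , r , VS≐ , ES≐ = treewidth-resp-≃ isGraph iso (realisation⇒treewidth (graphOf τ) r VS≐ ES≐)

  -- Instructive terms from tree decompositions

  open import Data.List.Membership.DecPropositional (Fin._≟_ {suc k}) using () renaming (_∈?_ to _∈L?_)

  freshLabel : List Label → Label
  freshLabel U with any? (λ c → ¬? (c ∈L? U)) (allFin (suc k))
  ... | yes found = proj₁ (satisfied found)
  ... | no _ = fzero

  private
    every∈ : ∀ U → ¬ Any.Any (λ c → ¬ (c ∈ U)) (allFin (suc k)) → ∀ c → c ∈ U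
    every∈ U none c with c ∈L? U
    ... | yes c∈ = c∈
    ... | no c∉ = ⊥-elim (none (Any.map (λ { refl → c∉ }) (∈-allFin c)))

  -- Otherwise all suc k labels occur in U, and two of them share a position.
  freshLabel∉ : ∀ U → length U < suc k → ¬ (freshLabel U ∈ U)
  freshLabel∉ U length< with any? (λ c → ¬? (c ∈L? U)) (allFin (suc k))
  ... | yes found = proj₂ (satisfied found)
  ... | no none with Fin.pigeonhole length< (λ c → Any.index (every∈ U none c))
  ...   | i , j , i<j , same-position =
    ⊥-elim (Fin.<-irrefl (trans (Any.lookup-index (every∈ U none i))
                                (trans (cong (lookup U) same-position) (sym (Any.lookup-index (every∈ U none j))))) i<j)

  record ColouringOn (Dom : ℕ → Set) (f : ℕ → Label) (U : List Label) : Set where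
    field
      colour∈ : ∀ y → Dom y → f y ∈ U
      injective : ∀ y z → Dom y → Dom z → f y ≡ f z → y ≡ z

  ColouringOn-update : ∀ {Dom f U x c} → ColouringOn Dom f U → ¬ Dom x → ¬ (c ∈ U) →
    ColouringOn (λ y → Dom y ⊎ y ≡ x) (update f x c) (c ∷ U)
  ColouringOn-update {Dom} {f} {U} {x} {c} col x∉ c∉ = record { colour∈ = colour∈' ; injective = injective' }
    where
    open ColouringOn col
    old : ∀ {y} → Dom y → update f x c y ≡ f y
    old {y} y∈ = update-other f x c y λ { refl → x∉ y∈ }
    colour∈' : ∀ y → Dom y ⊎ y ≡ x → update f x c y ∈ (c ∷ U)
    colour∈' y (inj₁ y∈) = there (subst (_∈ U) (sym (old y∈)) (colour∈ y y∈))
    colour∈' y (inj₂ refl) = here (update-same f y c)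
    injective' : ∀ y z → Dom y ⊎ y ≡ x → Dom z ⊎ z ≡ x → update f x c y ≡ update f x c z → y ≡ z
    injective' y z (inj₁ y∈) (inj₁ z∈) eq = injective y z y∈ z∈ (trans (sym (old y∈)) (trans eq (old z∈)))
    injective' y z (inj₁ y∈) (inj₂ refl) eq = ⊥-elim (c∉ (subst (_∈ U) (trans (sym (old y∈)) (trans eq (update-same f z c))) (colour∈ y y∈)))
    injective' y z (inj₂ refl) (inj₁ z∈) eq = ⊥-elim (c∉ (subst (_∈ U) (trans (sym (old z∈)) (trans (sym eq) (update-same f y c))) (colour∈ z z∈)))
    injective' y z (inj₂ refl) (inj₂ refl) _ = refl

  module Recolour (P : List ℕ) where

    recolour : List ℕ → (ℕ → Label) → List Label → ℕ → Label
    recolour [] f U = f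
    recolour (x ∷ xs) f U with x ∈ℕ? P
    ... | yes _ = recolour xs f U
    ... | no _ = recolour xs (update f x (freshLabel U)) (freshLabel U ∷ U)

    #new : List ℕ → ℕ
    #new [] = 0
    #new (x ∷ xs) with x ∈ℕ? P
    ... | yes _ = #new xs
    ... | no _ = suc (#new xs)

    New : List ℕ → ℕ → Set
    New xs y = y ∈ℕ xs × ¬ (y ∈ℕ P)

    recolour-cong : ∀ xs f f' U → (∀ y → f y ≡ f' y) → ∀ y → recolour xs f U y ≡ recolour xs f' U y
    recolour-cong [] f f' U f≗f' y = f≗f' y
    recolour-cong (x ∷ xs) f f' U f≗f' y with x ∈ℕ? P
    ... | yes _ = recolour-cong xs f f' U f≗f' y
    ... | no _ = recolour-cong xs _ _ _ updated≗ y
      where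
      updated≗ : ∀ z → update f x (freshLabel U) z ≡ update f' x (freshLabel U) z
      updated≗ z with z ≟ x
      ... | yes _ = refl
      ... | no _ = f≗f' z

    recolour-correct : ∀ xs {f U Dom} → Unique xs → ColouringOn Dom f U → length U + #new xs ≤ suc k →
      (∀ y → New xs y → ¬ Dom y) →
      (∀ y → ¬ New xs y → recolour xs f U y ≡ f y) ×
      (∀ y z → Dom y ⊎ New xs y → Dom z ⊎ New xs z → recolour xs f U y ≡ recolour xs f U z → y ≡ z)
    recolour-correct [] {f} {U} {Dom} _ col _ _ = (λ _ _ → refl) , injective
      where
      injective : ∀ y z → Dom y ⊎ New [] y → Dom z ⊎ New [] z → f y ≡ f z → y ≡ z
      injective y z (inj₁ y∈) (inj₁ z∈) = ColouringOn.injective col y z y∈ z∈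
      injective y z (inj₂ (() , _)) _
      injective y z (inj₁ _) (inj₂ (() , _))
    recolour-correct (x ∷ xs) {f} {U} {Dom} (x∉xs ∷ uniq) col bound new∉ with x ∈ℕ? P
    ... | yes x∈P =
      let (keeps , injective) = recolour-correct xs uniq col bound (λ y y-new → new∉ y (there (proj₁ y-new) , proj₂ y-new)) in
      (λ y not-new → keeps y (λ y-new → not-new (there (proj₁ y-new) , proj₂ y-new))) ,
      (λ y z y∈ z∈ → injective y z (shrink y y∈) (shrink z z∈))
      where
      shrink : ∀ y → Dom y ⊎ New (x ∷ xs) y → Dom y ⊎ New xs y
      shrink y (inj₁ y∈) = inj₁ y∈
      shrink y (inj₂ (here refl , y∉P)) = ⊥-elim (y∉P x∈P)
      shrink y (inj₂ (there y∈ , y∉P)) = inj₂ (y∈ , y∉P)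
    ... | no x∉P =
      let (keeps , injective) = recolour-correct xs uniq (ColouringOn-update col x∉Dom c∉U) bound' new∉'
      in (λ y not-new → trans (keeps y (λ y-new → not-new (there (proj₁ y-new) , proj₂ y-new)))
                              (update-other f x c y λ { refl → not-new (here refl , x∉P) })) ,
         (λ y z y∈ z∈ → injective y z (shift y y∈) (shift z z∈))
      where
      c : Label
      c = freshLabel U
      bound' : length (c ∷ U) + #new xs ≤ suc k
      bound' = ℕ.≤-trans (ℕ.≤-reflexive (sym (ℕ.+-suc (length U) (#new xs)))) bound
      c∉U : ¬ (c ∈ U)
      c∉U = freshLabel∉ U (ℕ.≤-trans (s≤s (ℕ.m≤m+n (length U) (#new xs))) bound')
      x∉Dom : ¬ Dom x
      x∉Dom = new∉ x (here refl , x∉P)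
      new∉' : ∀ y → New xs y → ¬ (Dom y ⊎ y ≡ x)
      new∉' y (y∈ , y∉P) (inj₁ y∈Dom) = new∉ y (there y∈ , y∉P) y∈Dom
      new∉' y (y∈ , _) (inj₂ refl) = All.lookup x∉xs y∈ refl
      shift : ∀ y → Dom y ⊎ New (x ∷ xs) y → (Dom y ⊎ y ≡ x) ⊎ New xs y
      shift y (inj₁ y∈) = inj₁ (inj₁ y∈)
      shift y (inj₂ (here refl , _)) = inj₁ (inj₂ refl)
      shift y (inj₂ (there y∈ , y∉P)) = inj₂ (y∈ , y∉P)

    kept : List ℕ → List ℕ
    kept L = filter (_∈ℕ? P) L

    kept+new : ∀ L → length (kept L) + #new L ≡ length L
    kept+new [] = refl
    kept+new (x ∷ xs) with x ∈ℕ? P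
    ... | yes _ = cong suc (kept+new xs)
    ... | no _ = trans (ℕ.+-suc (length (kept xs)) (#new xs)) (cong suc (kept+new xs))

    -- Colours the bag L: vertices shared with the parent bag P keep the parent's
    -- colour pc, the others receive distinct unused labels.
    extendColouring : List ℕ → (ℕ → Label) → ℕ → Label
    extendColouring L pc = recolour L pc (map pc (kept L))

    extendColouring-correct : ∀ L pc → Unique L → length L ≤ suc k →
      (∀ y z → y ∈ℕ L → y ∈ℕ P → z ∈ℕ L → z ∈ℕ P → pc y ≡ pc z → y ≡ z) →
      (∀ y → y ∈ℕ L → y ∈ℕ P → extendColouring L pc y ≡ pc y) ×
      (∀ y z → y ∈ℕ L → z ∈ℕ L → extendColouring L pc y ≡ extendColouring L pc z → y ≡ z)
    extendColouring-correct L pc uniq length≤ pc-inj =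
      let (keeps , injective) = recolour-correct L uniq col bound (λ y y-new y-kept → proj₂ y-new (proj₂ y-kept))
      in (λ y y∈L y∈P → keeps y (λ y-new → proj₂ y-new y∈P)) ,
         (λ y z y∈ z∈ → injective y z (classify y y∈) (classify z z∈))
      where
      Kept : ℕ → Set
      Kept y = y ∈ℕ L × y ∈ℕ P
      col : ColouringOn Kept pc (map pc (kept L))
      col = record { colour∈ = λ y y-kept → ∈-map⁺ pc (∈-filter⁺ (_∈ℕ? P) (proj₁ y-kept) (proj₂ y-kept))
                   ; injective = λ y z (y∈ , y∈P) (z∈ , z∈P) → pc-inj y z y∈ y∈P z∈ z∈P }
      bound : length (map pc (kept L)) + #new L ≤ suc k
      bound = ℕ.≤-trans (ℕ.≤-reflexive (trans (cong (_+ #new L) (List.length-map pc (kept L))) (kept+new L))) length≤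
      classify : ∀ y → y ∈ℕ L → Kept y ⊎ New L y
      classify y y∈ with y ∈ℕ? P
      ... | yes y∈P = inj₁ (y∈ , y∈P)
      ... | no y∉P = inj₂ (y∈ , y∉P)

    extendColouring-cong : ∀ L pc pc' → (∀ y → pc y ≡ pc' y) → ∀ y → extendColouring L pc y ≡ extendColouring L pc' y
    extendColouring-cong L pc pc' pc≗ y =
      trans (recolour-cong L pc pc' _ pc≗ y) (cong (λ U → recolour L pc' U y) (List.map-cong pc≗ (kept L)))

  module Colouring (T : Tree) (bag : Node T → List ℕ) (bag-unique : ∀ t → Unique (bag t))
    (width : ∀ t → length (bag t) ≤ suc k) where

    private
      colourFuel : ℕ → Node T → ℕ → Label
      colourFuel zero t = λ _ → fzero
      colourFuel (suc n) fzero = Recolour.extendColouring [] (bag fzero) (λ _ → fzero)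
      colourFuel (suc n) (fsuc i) = Recolour.extendColouring (bag (parent T i)) (bag (fsuc i)) (colourFuel n (parent T i))

      colourFuel-irrelevant : ∀ n n' t → toℕ t < n → toℕ t < n' → ∀ x → colourFuel n t x ≡ colourFuel n' t x
      colourFuel-irrelevant (suc n) (suc n') fzero _ _ x = refl
      colourFuel-irrelevant (suc n) (suc n') (fsuc i) (s≤s t<n) (s≤s t<n') x =
        Recolour.extendColouring-cong (bag (parent T i)) (bag (fsuc i)) _ _
          (colourFuel-irrelevant n n' (parent T i) (ℕ.≤-<-trans (parent-< T i) t<n) (ℕ.≤-<-trans (parent-< T i) t<n')) x

      colourFuel-injective : ∀ n t → toℕ t < n → ∀ x y → x ∈ℕ bag t → y ∈ℕ bag t → colourFuel n t x ≡ colourFuel n t y → x ≡ y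
      colourFuel-injective (suc n) fzero _ x y x∈ y∈ eq =
        proj₂ (Recolour.extendColouring-correct [] (bag fzero) (λ _ → fzero) (bag-unique fzero) (width fzero) (λ _ _ _ ())) x y x∈ y∈ eq
      colourFuel-injective (suc n) (fsuc i) (s≤s t<n) x y x∈ y∈ eq =
        proj₂ (Recolour.extendColouring-correct (bag (parent T i)) (bag (fsuc i)) (colourFuel n (parent T i)) (bag-unique (fsuc i)) (width (fsuc i))
          (λ a b _ a∈ _ b∈ → colourFuel-injective n (parent T i) (ℕ.≤-<-trans (parent-< T i) t<n) a b a∈ b∈)) x y x∈ y∈ eq

    colour : Node T → ℕ → Label
    colour t = colourFuel (suc (toℕ t)) t

    colour-injective : ∀ t x y → x ∈ℕ bag t → y ∈ℕ bag t → colour t x ≡ colour t y → x ≡ y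
    colour-injective t = colourFuel-injective (suc (toℕ t)) t ℕ.≤-refl

    colour-parent : ∀ i x → x ∈ℕ bag (fsuc i) → x ∈ℕ bag (parent T i) → colour (fsuc i) x ≡ colour (parent T i) x
    colour-parent i x x∈ x∈parent =
      trans (proj₁ (Recolour.extendColouring-correct (bag (parent T i)) (bag (fsuc i)) (colourFuel (suc (toℕ i)) (parent T i))
                      (bag-unique (fsuc i)) (width (fsuc i))
                      (λ a b _ a∈ _ b∈ → colourFuel-injective (suc (toℕ i)) (parent T i) (s≤s (parent-< T i)) a b a∈ b∈)) x x∈ x∈parent)
            (colourFuel-irrelevant (suc (toℕ i)) (suc (toℕ (parent T i))) (parent T i) (s≤s (parent-< T i)) ℕ.≤-refl x)

  Term : Set
  Term = Σ LabelSet (ITD k)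

  introduceAll : List ℕ → (ℕ → Label) → Term → Term
  introduceAll [] c τ = τ
  introduceAll (y ∷ ys) c (B , σ) with c y Subset.∈? B
  ... | yes _ = introduceAll ys c (B , σ)
  ... | no c∉ = introduceAll ys c (B ∪ ⁅ c y ⁆ , IntroVertex (c y) c∉ σ)

  forgetOutside : List ℕ → (ℕ → Label) → List ℕ → Term → Term
  forgetOutside [] c keep τ = τ
  forgetOutside (x ∷ xs) c keep (B , σ) with x ∈ℕ? keep | c x Subset.∈? B
  ... | no _ | yes c∈ = forgetOutside xs c keep (B - c x , ForgetVertex (c x) c∈ σ)
  ... | yes _ | _ = forgetOutside xs c keep (B , σ)
  ... | no _ | no _ = forgetOutside xs c keep (B , σ)

  introduceAll-active⁻ : ∀ ys c B (σ : ITD k B) u → u ∈s proj₁ (introduceAll ys c (B , σ)) →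
    u ∈s B ⊎ ∃[ y ] (y ∈ℕ ys × c y ≡ u)
  introduceAll-active⁻ [] c B σ u u∈ = inj₁ u∈
  introduceAll-active⁻ (y ∷ ys) c B σ u u∈ with c y Subset.∈? B
  ... | yes _ = Sum.map₂ (λ (z , z∈ , eq) → z , there z∈ , eq) (introduceAll-active⁻ ys c B σ u u∈)
  ... | no _ with introduceAll-active⁻ ys c _ _ u u∈
  ...   | inj₂ (z , z∈ , eq) = inj₂ (z , there z∈ , eq)
  ...   | inj₁ u∈' = Sum.map₂ (λ u≡ → y , here refl , sym u≡) (x∈p∪⁅y⁆⁻ {p = B} u∈')

  introduceAll-active⁺ : ∀ ys c B (σ : ITD k B) u → u ∈s B ⊎ ∃[ y ] (y ∈ℕ ys × c y ≡ u) →
    u ∈s proj₁ (introduceAll ys c (B , σ))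
  introduceAll-active⁺ [] c B σ u (inj₁ u∈) = u∈
  introduceAll-active⁺ [] c B σ u (inj₂ (y , () , _))
  introduceAll-active⁺ (y ∷ ys) c B σ u old-or-new with c y Subset.∈? B | old-or-new
  ... | yes _ | inj₁ u∈ = introduceAll-active⁺ ys c B σ u (inj₁ u∈)
  ... | yes cy∈ | inj₂ (z , here refl , refl) = introduceAll-active⁺ ys c B σ u (inj₁ cy∈)
  ... | yes _ | inj₂ (z , there z∈ , eq) = introduceAll-active⁺ ys c B σ u (inj₂ (z , z∈ , eq))
  ... | no _ | inj₁ u∈ = introduceAll-active⁺ ys c _ _ u (inj₁ (Subset.x∈p∪q⁺ (inj₁ u∈)))
  ... | no _ | inj₂ (z , here refl , refl) = introduceAll-active⁺ ys c _ _ u (inj₁ (y∈p∪⁅y⁆ {p = B} (c z)))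
  ... | no _ | inj₂ (z , there z∈ , eq) = introduceAll-active⁺ ys c _ _ u (inj₂ (z , z∈ , eq))

  forgetOutside-active⁻ : ∀ xs c keep B (σ : ITD k B) u → u ∈s proj₁ (forgetOutside xs c keep (B , σ)) →
    u ∈s B × (∀ x → x ∈ℕ xs → ¬ (x ∈ℕ keep) → c x ≢ u)
  forgetOutside-active⁻ [] c keep B σ u u∈ = u∈ , λ x ()
  forgetOutside-active⁻ (x ∷ xs) c keep B σ u u∈ with x ∈ℕ? keep | c x Subset.∈? B
  ... | no _ | yes _ =
    let (u∈B-cx , forgotten) = forgetOutside-active⁻ xs c keep _ _ u u∈
        (u∈B , u≢cx) = x∈p-y⇒x∈p×x≢y {p = B} u∈B-cx
    in u∈B , λ { z (here refl) _ eq → u≢cx (sym eq) ; z (there z∈) z∉ eq → forgotten z z∈ z∉ eq }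
  ... | yes x∈keep | _ = let (u∈B , forgotten) = forgetOutside-active⁻ xs c keep B σ u u∈ in
    u∈B , λ { z (here refl) z∉ _ → z∉ x∈keep ; z (there z∈) z∉ eq → forgotten z z∈ z∉ eq }
  ... | no _ | no cx∉ = let (u∈B , forgotten) = forgetOutside-active⁻ xs c keep B σ u u∈ in
    u∈B , λ { z (here refl) _ refl → cx∉ u∈B ; z (there z∈) z∉ eq → forgotten z z∈ z∉ eq }

  forgetOutside-active⁺ : ∀ xs c keep B (σ : ITD k B) u → u ∈s B → (∀ x → x ∈ℕ xs → ¬ (x ∈ℕ keep) → c x ≢ u) →
    u ∈s proj₁ (forgetOutside xs c keep (B , σ))
  forgetOutside-active⁺ [] c keep B σ u u∈ _ = u∈
  forgetOutside-active⁺ (x ∷ xs) c keep B σ u u∈ kept with x ∈ℕ? keep | c x Subset.∈? B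
  ... | no x∉keep | yes _ = forgetOutside-active⁺ xs c keep _ _ u (Subset.x∈p∧x≢y⇒x∈p-y u∈ (λ eq → kept x (here refl) x∉keep (sym eq)))
                                                  (λ z z∈ → kept z (there z∈))
  ... | yes _ | _ = forgetOutside-active⁺ xs c keep B σ u u∈ (λ z z∈ → kept z (there z∈))
  ... | no _ | no _ = forgetOutside-active⁺ xs c keep B σ u u∈ (λ z z∈ → kept z (there z∈))

  forgetOutside-realises : ∀ {H} xs c keep B (σ : ITD k B) {VS ES α} → Realises H σ VS ES α →
    Realises H (proj₂ (forgetOutside xs c keep (B , σ))) VS ES α
  forgetOutside-realises [] c keep B σ r = r
  forgetOutside-realises (x ∷ xs) c keep B σ r with x ∈ℕ? keep | c x Subset.∈? B
  ... | no _ | yes _ = forgetOutside-realises xs c keep _ _ (forgetVertex r (λ _ → refl))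
  ... | yes _ | _ = forgetOutside-realises xs c keep B σ r
  ... | no _ | no _ = forgetOutside-realises xs c keep B σ r

  record IntroducedRealisation (H : Incidence) (τ : Term) (ys : List ℕ) (c : ℕ → Label) (B : LabelSet)
    (VS ES : List ℕ) (α : Label → ℕ) : Set where
    field
      vertices : List ℕ
      labelling : Label → ℕ
      realises : Realises H (proj₂ τ) vertices ES labelling
      vertices⁻ : ∀ x → x ∈ℕ vertices → x ∈ℕ VS ⊎ x ∈ℕ ys
      vertices⁺ : ∀ x → x ∈ℕ VS → x ∈ℕ vertices
      introduced∈ : ∀ y → y ∈ℕ ys → y ∈ℕ vertices
      labelling-old : ∀ u → u ∈s B → labelling u ≡ α u
      labelling-new : ∀ y → y ∈ℕ ys → labelling (c y) ≡ y

  introduceAll-realises : ∀ {H} ys c B (σ : ITD k B) {VS ES α} → Realises H σ VS ES α → Unique ys →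
    (∀ y z → y ∈ℕ ys → z ∈ℕ ys → c y ≡ c z → y ≡ z) →
    (∀ y → y ∈ℕ ys → c y ∈s B → α (c y) ≡ y) →
    (∀ y → y ∈ℕ ys → c y ∉s B → ¬ (y ∈ℕ VS)) →
    IntroducedRealisation H (introduceAll ys c (B , σ)) ys c B VS ES α
  introduceAll-realises [] c B σ {VS} {ES} {α} r _ _ _ _ = record
    { vertices = VS ; labelling = α ; realises = r ; vertices⁻ = λ _ x∈ → inj₁ x∈ ; vertices⁺ = λ _ x∈ → x∈
    ; introduced∈ = λ _ () ; labelling-old = λ _ _ → refl ; labelling-new = λ _ () }
  introduceAll-realises {H} (y ∷ ys) c B σ {VS} {ES} {α} r (y∉ys ∷ uniq) c-inj labelled fresh with c y Subset.∈? B
  ... | yes cy∈ = record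
    { vertices = vertices ; labelling = labelling ; realises = realises
    ; vertices⁻ = λ x x∈ → Sum.map₂ there (vertices⁻ x x∈) ; vertices⁺ = vertices⁺
    ; introduced∈ = λ { z (here refl) → vertices⁺ z (subst (_∈ℕ VS) (labelled z (here refl) cy∈) (active∈ r (c z) cy∈))
                      ; z (there z∈) → introduced∈ z z∈ }
    ; labelling-old = labelling-old
    ; labelling-new = λ { z (here refl) → trans (labelling-old (c z) cy∈) (labelled z (here refl) cy∈) ; z (there z∈) → labelling-new z z∈ } }
    where
    open IntroducedRealisation
      (introduceAll-realises ys c B σ r uniq (λ a b a∈ b∈ → c-inj a b (there a∈) (there b∈))
        (λ a a∈ → labelled a (there a∈)) (λ a a∈ → fresh a (there a∈)))
  ... | no cy∉ = record
    { vertices = vertices ; labelling = labelling ; realises = realises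
    ; vertices⁻ = λ x x∈ → [ (λ { (here refl) → inj₂ (here refl) ; (there x∈VS) → inj₁ x∈VS }) , (λ x∈ys → inj₂ (there x∈ys)) ] (vertices⁻ x x∈)
    ; vertices⁺ = λ x x∈ → vertices⁺ x (there x∈)
    ; introduced∈ = λ { z (here refl) → vertices⁺ z (here refl) ; z (there z∈) → introduced∈ z z∈ }
    ; labelling-old = λ v v∈ → trans (labelling-old v (Subset.x∈p∪q⁺ (inj₁ v∈))) (update-other α (c y) y v λ { refl → cy∉ v∈ })
    ; labelling-new = λ { z (here refl) → trans (labelling-old (c z) (y∈p∪⁅y⁆ {p = B} (c z))) (update-same α (c z) z)
                        ; z (there z∈) → labelling-new z z∈ } }
    where
    cz≢cy : ∀ z → z ∈ℕ ys → c z ≢ c y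
    cz≢cy z z∈ eq = All.lookup y∉ys z∈ (c-inj y z (here refl) (there z∈) (sym eq))
    labelled' : ∀ z → z ∈ℕ ys → c z ∈s B ∪ ⁅ c y ⁆ → update α (c y) y (c z) ≡ z
    labelled' z z∈ cz∈ with x∈p∪⁅y⁆⁻ {p = B} cz∈
    ... | inj₁ cz∈B = trans (update-other α (c y) y (c z) (cz≢cy z z∈)) (labelled z (there z∈) cz∈B)
    ... | inj₂ eq = ⊥-elim (cz≢cy z z∈ eq)
    fresh' : ∀ z → z ∈ℕ ys → c z ∉s B ∪ ⁅ c y ⁆ → ¬ (z ∈ℕ (y ∷ VS))
    fresh' z z∈ _ (here refl) = All.lookup y∉ys z∈ refl
    fresh' z z∈ cz∉ (there z∈VS) = fresh z (there z∈) (λ cz∈B → cz∉ (Subset.x∈p∪q⁺ (inj₁ cz∈B))) z∈VS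
    open IntroducedRealisation
      (introduceAll-realises ys c _ _ (introVertex {u∉ = cy∉} r (fresh y (here refl) cy∉) (λ _ → refl)) uniq
        (λ a b a∈ b∈ → c-inj a b (there a∈) (there b∈)) labelled' fresh')

  module FromDecomposition (G : Graph) (isGraph : IsGraph G) (D : TreeDecomposition G) (width : WidthAtMost D k) where

    open Descendants (tree D)
    open Colouring (tree D) (bag D) (bag-unique D) width

    T : Tree
    T = tree D

    record PlacedEdge : Set where
      field
        edge : ℕ
        node : Node T
        end₁ end₂ : ℕ
        ends-distinct : end₁ ≢ end₂
        ends : Ends (I G) edge end₁ end₂
        end₁∈ : end₁ ∈ℕ bag D node
        end₂∈ : end₂ ∈ℕ bag D node
    open PlacedEdge

    placeEdge : ∀ e → e ∈ℕ E G → PlacedEdge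
    placeEdge e e∈ with IsGraph.two-ends isGraph e e∈ | cover-edges D e e∈
    ... | a , b , a≢b , a-inc , b-inc , only-ab | t , covered = record
      { edge = e ; node = t ; end₁ = a ; end₂ = b ; ends-distinct = a≢b
      ; ends = λ v → only-ab v , (λ { (inj₁ refl) → a-inc ; (inj₂ refl) → b-inc })
      ; end₁∈ = covered a a-inc ; end₂∈ = covered b b-inc }

    placeEdge-edge : ∀ e e∈ → edge (placeEdge e e∈) ≡ e
    placeEdge-edge e e∈ with IsGraph.two-ends isGraph e e∈ | cover-edges D e e∈
    ... | _ | _ = refl

    placeEdges : (es : List ℕ) → (∀ e → e ∈ℕ es → e ∈ℕ E G) → List PlacedEdge
    placeEdges [] _ = []
    placeEdges (e ∷ es) es⊆ = placeEdge e (es⊆ e (here refl)) ∷ placeEdges es (λ e' e'∈ → es⊆ e' (there e'∈))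

    placeEdges-edges : ∀ es es⊆ → map edge (placeEdges es es⊆) ≡ es
    placeEdges-edges [] _ = refl
    placeEdges-edges (e ∷ es) es⊆ = cong₂ _∷_ (placeEdge-edge e (es⊆ e (here refl))) (placeEdges-edges es _)

    -- E G may list an edge twice; every edge must be introduced exactly once.
    placements : List PlacedEdge
    placements = placeEdges (deduplicate ℕ._≟_ (E G)) (λ e e∈ → ∈-deduplicate⁻ ℕ._≟_ (E G) e∈)

    placements-edges : map edge placements ≡ deduplicate ℕ._≟_ (E G)
    placements-edges = placeEdges-edges _ _

    placements-unique : Unique (map edge placements)
    placements-unique = subst Unique (sym placements-edges) (UniqueDec.deduplicate-! ℕ._≟_ (E G))

    placement-edge∈ : ∀ {p} → p ∈ placements → edge p ∈ℕ E G
    placement-edge∈ p∈ = ∈-deduplicate⁻ ℕ._≟_ (E G) (subst (_ ∈ℕ_) placements-edges (∈-map⁺ edge p∈))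

    placement-exists : ∀ e → e ∈ℕ E G → ∃[ p ] (p ∈ placements × edge p ≡ e)
    placement-exists e e∈ with ∈-map⁻ edge (subst (e ∈ℕ_) (sym placements-edges) (∈-deduplicate⁺ ℕ._≟_ e∈))
    ... | p , p∈ , e≡ = p , p∈ , sym e≡

    edge-injective : ∀ {ps : List PlacedEdge} → Unique (map edge ps) → ∀ {p q} → p ∈ ps → q ∈ ps → edge p ≡ edge q → p ≡ q
    edge-injective (_ ∷ _) (here refl) (here refl) _ = refl
    edge-injective (p∉ ∷ _) (here refl) (there q∈) eq = ⊥-elim (All.lookup p∉ (∈-map⁺ edge q∈) eq)
    edge-injective (q∉ ∷ _) (there p∈) (here refl) eq = ⊥-elim (All.lookup q∉ (∈-map⁺ edge p∈) (sym eq))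
    edge-injective (_ ∷ uniq) (there p∈) (there q∈) eq = edge-injective uniq p∈ q∈ eq

    bagTerm : Node T → Term
    bagTerm t = introduceAll (bag D t) (colour t) (∅ , Leaf)

    bagLabels : Node T → LabelSet
    bagLabels t = proj₁ (bagTerm t)

    bagLabels⁻ : ∀ t u → u ∈s bagLabels t → ∃[ x ] (x ∈ℕ bag D t × colour t x ≡ u)
    bagLabels⁻ t u u∈ with introduceAll-active⁻ (bag D t) (colour t) ∅ Leaf u u∈
    ... | inj₁ u∈∅ = ⊥-elim (Subset.∉⊥ u∈∅)
    ... | inj₂ labelled = labelled

    bagLabels⁺ : ∀ t x → x ∈ℕ bag D t → colour t x ∈s bagLabels t
    bagLabels⁺ t x x∈ = introduceAll-active⁺ (bag D t) (colour t) ∅ Leaf (colour t x) (inj₂ (x , x∈ , refl))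

    toParentTerm : ∀ i {t} → parent T i ≡ t → ITD k (bagLabels (fsuc i)) → Term
    toParentTerm i {t} _ σ = introduceAll (bag D t) (colour t) (forgetOutside (bag D (fsuc i)) (colour (fsuc i)) (bag D t) (bagLabels (fsuc i) , σ))

    toParentTerm-labels : ∀ i {t} (i→t : parent T i ≡ t) σ → proj₁ (toParentTerm i i→t σ) ≡ bagLabels t
    toParentTerm-labels i refl σ = Subset.⊆-antisym to from
      where
      s t : Node T
      s = fsuc i
      t = parent T i
      to : ∀ {u} → u ∈s proj₁ (toParentTerm i refl σ) → u ∈s bagLabels t
      to {u} u∈ with introduceAll-active⁻ (bag D t) (colour t) _ _ u u∈
      ... | inj₂ (y , y∈ , refl) = bagLabels⁺ t y y∈
      ... | inj₁ u∈forgotten with forgetOutside-active⁻ (bag D s) (colour s) (bag D t) (bagLabels s) σ u u∈forgotten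
      ...   | u∈s , kept with bagLabels⁻ s u u∈s
      ...     | x , x∈s , refl with x ∈ℕ? bag D t
      ...       | yes x∈t = subst (_∈s bagLabels t) (sym (colour-parent i x x∈s x∈t)) (bagLabels⁺ t x x∈t)
      ...       | no x∉t = ⊥-elim (kept x x∈s x∉t refl)
      from : ∀ {u} → u ∈s bagLabels t → u ∈s proj₁ (toParentTerm i refl σ)
      from {u} u∈ = introduceAll-active⁺ (bag D t) (colour t) _ _ u (inj₂ (bagLabels⁻ t u u∈))

    toParent : ∀ i {t} → parent T i ≡ t → ITD k (bagLabels (fsuc i)) → ITD k (bagLabels t)
    toParent i i→t σ = subst (ITD k) (toParentTerm-labels i i→t σ) (proj₂ (toParentTerm i i→t σ))

    introduceEdges : List PlacedEdge → (t : Node T) → ITD k (bagLabels t) → ITD k (bagLabels t)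
    introduceEdges [] t σ = σ
    introduceEdges (p ∷ ps) t σ with node p Fin.≟ t
    ... | yes refl = IntroEdge (colour t (end₁ p)) (colour t (end₂ p))
                       (λ eq → ends-distinct p (colour-injective t _ _ (end₁∈ p) (end₂∈ p) eq))
                       (bagLabels⁺ t (end₁ p) (end₁∈ p)) (bagLabels⁺ t (end₂ p) (end₂∈ p)) (introduceEdges ps t σ)
    ... | no _ = introduceEdges ps t σ

    -- The fuel bounds the height of the subtree rooted at t.
    mutual
      subtreeTerm : ℕ → (t : Node T) → ITD k (bagLabels t)
      subtreeTerm zero t = proj₂ (bagTerm t)
      subtreeTerm (suc f) t = introduceEdges placements t (joinChildren f t (allFin (m T)) (proj₂ (bagTerm t)))

      joinChildren : ℕ → (t : Node T) → List (Fin (m T)) → ITD k (bagLabels t) → ITD k (bagLabels t)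
      joinChildren f t [] acc = acc
      joinChildren f t (i ∷ is) acc with parent T i Fin.≟ t
      ... | yes i→t = Join (toParent i i→t (subtreeTerm f (fsuc i))) (joinChildren f t is acc)
      ... | no _ = joinChildren f t is acc

    record Spans {B} (τ : ITD k B) (PV PE : ℕ → Set) (t : Node T) : Set where
      field
        VS ES : List ℕ
        α : Label → ℕ
        realises : Realises (I G) τ VS ES α
        VS⁻ : ∀ x → x ∈ℕ VS → PV x
        VS⁺ : ∀ x → PV x → x ∈ℕ VS
        ES⁻ : ∀ e → e ∈ℕ ES → PE e
        ES⁺ : ∀ e → PE e → e ∈ℕ ES
        labels-bag : ∀ x → x ∈ℕ bag D t → α (colour t x) ≡ x

    Spans-resp : ∀ {B} {τ : ITD k B} {PV PE PV' PE' t} → Spans τ PV PE t →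
      (∀ x → PV x → PV' x) → (∀ x → PV' x → PV x) → (∀ e → PE e → PE' e) → (∀ e → PE' e → PE e) → Spans τ PV' PE' t
    Spans-resp S PV⊆ PV⊇ PE⊆ PE⊇ = record
      { VS = VS ; ES = ES ; α = α ; realises = realises
      ; VS⁻ = λ x x∈ → PV⊆ x (VS⁻ x x∈) ; VS⁺ = λ x px → VS⁺ x (PV⊇ x px)
      ; ES⁻ = λ e e∈ → PE⊆ e (ES⁻ e e∈) ; ES⁺ = λ e pe → ES⁺ e (PE⊇ e pe) ; labels-bag = labels-bag }
      where open Spans S

    Spans-subst : ∀ {B B'} (eq : B ≡ B') {τ : ITD k B} {PV PE t} → Spans τ PV PE t → Spans (subst (ITD k) eq τ) PV PE t
    Spans-subst refl S = S

    InSubtree : Node T → ℕ → Set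
    InSubtree t x = ∃[ y ] (t ≼ y × x ∈ℕ bag D y)

    PlacedInSubtree : Node T → ℕ → Set
    PlacedInSubtree t e = ∃[ p ] (p ∈ placements × edge p ≡ e × t ≼ node p)

    bagTerm-spans : ∀ t → Spans (proj₂ (bagTerm t)) (_∈ℕ bag D t) (λ _ → ⊥) t
    bagTerm-spans t = record
      { VS = vertices ; ES = [] ; α = labelling ; realises = realises
      ; VS⁻ = λ x x∈ → [ (λ ()) , (λ x∈bag → x∈bag) ] (vertices⁻ x x∈) ; VS⁺ = introduced∈
      ; ES⁻ = λ _ () ; ES⁺ = λ _ () ; labels-bag = labelling-new }
      where
      open IntroducedRealisation
        (introduceAll-realises (bag D t) (colour t) ∅ Leaf {α = λ _ → 0} leaf (bag-unique D t) (colour-injective t)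
          (λ _ _ u∈ → ⊥-elim (Subset.∉⊥ u∈)) (λ _ _ _ ()))

    -- A vertex of the parent bag that already occurs below fsuc i lies in the bag
    -- of fsuc i (by connectivity), so it keeps its label through toParent.
    toParent-spans : ∀ i {t} (i→t : parent T i ≡ t) σ → Spans σ (InSubtree (fsuc i)) (PlacedInSubtree (fsuc i)) (fsuc i) →
      Spans (toParent i i→t σ) (λ x → InSubtree (fsuc i) x ⊎ x ∈ℕ bag D t) (PlacedInSubtree (fsuc i)) t
    toParent-spans i refl σ S = Spans-subst (toParentTerm-labels i refl σ) spans
      where
      s t : Node T
      s = fsuc i
      t = parent T i
      open Spans S
      forgotten : Term
      forgotten = forgetOutside (bag D s) (colour s) (bag D t) (bagLabels s , σ)
      realises-forgotten : Realises (I G) (proj₂ forgotten) VS ES α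
      realises-forgotten = forgetOutside-realises (bag D s) (colour s) (bag D t) (bagLabels s) σ realises
      labelled : ∀ y → y ∈ℕ bag D t → colour t y ∈s proj₁ forgotten → α (colour t y) ≡ y
      labelled y y∈t cy∈ with forgetOutside-active⁻ (bag D s) (colour s) (bag D t) (bagLabels s) σ (colour t y) cy∈
      ... | cy∈s , kept with bagLabels⁻ s (colour t y) cy∈s
      ...   | x , x∈s , cx≡ with x ∈ℕ? bag D t
      ...     | no x∉t = ⊥-elim (kept x x∈s x∉t cx≡)
      ...     | yes x∈t with colour-injective t x y x∈t y∈t (trans (sym (colour-parent i x x∈s x∈t)) cx≡)
      ...       | refl = trans (cong α (sym cx≡)) (labels-bag x x∈s)
      fresh : ∀ y → y ∈ℕ bag D t → ¬ (colour t y ∈s proj₁ forgotten) → ¬ (y ∈ℕ VS)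
      fresh y y∈t cy∉ y∈VS with VS⁻ y y∈VS
      ... | z , s≼z , y∈z =
        let y∈s = proj₁ (PathIn-leaves-subtree i (connected D y z t y∈z y∈t) s≼z (parent⋠child i))
            cy∈ : colour s y ∈s proj₁ forgotten
            cy∈ = forgetOutside-active⁺ (bag D s) (colour s) (bag D t) (bagLabels s) σ (colour s y) (bagLabels⁺ s y y∈s)
                    (λ x x∈s x∉t eq → x∉t (subst (_∈ℕ bag D t) (sym (colour-injective s x y x∈s y∈s eq)) y∈t))
        in cy∉ (subst (_∈s proj₁ forgotten) (colour-parent i y y∈s y∈t) cy∈)
      open IntroducedRealisation
        (introduceAll-realises (bag D t) (colour t) (proj₁ forgotten) (proj₂ forgotten) realises-forgotten
          (bag-unique D t) (colour-injective t) labelled fresh)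
        renaming (realises to realises-introduced)
      spans : Spans (proj₂ (toParentTerm i refl σ)) (λ x → InSubtree s x ⊎ x ∈ℕ bag D t) (PlacedInSubtree s) t
      spans = record
        { VS = vertices ; ES = ES ; α = labelling ; realises = realises-introduced
        ; VS⁻ = λ x x∈ → Sum.map₁ (VS⁻ x) (vertices⁻ x x∈)
        ; VS⁺ = λ x → [ (λ x-below → vertices⁺ x (VS⁺ x x-below)) , introduced∈ x ]
        ; ES⁻ = ES⁻ ; ES⁺ = ES⁺ ; labels-bag = labelling-new }

    join-spans : ∀ {t} {σ₁ σ₂ : ITD k (bagLabels t)} {PV₁ PE₁ PV₂ PE₂} → Spans σ₁ PV₁ PE₁ t → Spans σ₂ PV₂ PE₂ t →
      (∀ x → PV₁ x → PV₂ x → x ∈ℕ bag D t) → (∀ e → PE₁ e → PE₂ e → ⊥) →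
      Spans (Join σ₁ σ₂) (λ x → PV₁ x ⊎ PV₂ x) (λ e → PE₁ e ⊎ PE₂ e) t
    join-spans {t} S₁ S₂ shared disjoint = record
      { VS = VS S₁ ++ VS S₂ ; ES = ES S₁ ++ ES S₂ ; α = α S₁
      ; realises = join (realises S₁) (realises S₂) agree shared' disjoint' (λ _ → refl)
      ; VS⁻ = λ x x∈ → Sum.map (VS⁻ S₁ x) (VS⁻ S₂ x) (∈-++⁻ (VS S₁) x∈)
      ; VS⁺ = λ x → [ (λ p → ∈-++⁺ˡ (VS⁺ S₁ x p)) , (λ p → ∈-++⁺ʳ (VS S₁) (VS⁺ S₂ x p)) ]
      ; ES⁻ = λ e e∈ → Sum.map (ES⁻ S₁ e) (ES⁻ S₂ e) (∈-++⁻ (ES S₁) e∈)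
      ; ES⁺ = λ e → [ (λ p → ∈-++⁺ˡ (ES⁺ S₁ e p)) , (λ p → ∈-++⁺ʳ (ES S₁) (ES⁺ S₂ e p)) ]
      ; labels-bag = labels-bag S₁ }
      where
      open Spans
      agree : ∀ u → u ∈s bagLabels t → α S₂ u ≡ α S₁ u
      agree u u∈ with bagLabels⁻ t u u∈
      ... | x , x∈ , refl = trans (labels-bag S₂ x x∈) (sym (labels-bag S₁ x x∈))
      shared' : ∀ x → x ∈ℕ VS S₁ → x ∈ℕ VS S₂ → ∃[ u ] (u ∈s bagLabels t × x ≡ α S₁ u)
      shared' x x∈₁ x∈₂ = let x∈t = shared x (VS⁻ S₁ x x∈₁) (VS⁻ S₂ x x∈₂) in
        colour t x , bagLabels⁺ t x x∈t , sym (labels-bag S₁ x x∈t)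
      disjoint' : ∀ e → e ∈ℕ ES S₁ → ¬ (e ∈ℕ ES S₂)
      disjoint' e e∈₁ e∈₂ = disjoint e (ES⁻ S₁ e e∈₁) (ES⁻ S₂ e e∈₂)

    ChildVertex : Node T → List (Fin (m T)) → ℕ → Set
    ChildVertex t is x = x ∈ℕ bag D t ⊎ ∃[ i ] (i ∈ is × parent T i ≡ t × InSubtree (fsuc i) x)

    ChildEdge : Node T → List (Fin (m T)) → ℕ → Set
    ChildEdge t is e = ∃[ i ] (i ∈ is × parent T i ≡ t × PlacedInSubtree (fsuc i) e)

    -- Distinct children have disjoint subtrees, so their terms share only vertices
    -- of the parent bag (by connectivity) and no placed edges.
    joinChildren-spans : ∀ f t (is : List (Fin (m T))) (acc : ITD k (bagLabels t)) → Unique is →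
      Spans acc (_∈ℕ bag D t) (λ _ → ⊥) t →
      (∀ i → i ∈ is → parent T i ≡ t → Spans (subtreeTerm f (fsuc i)) (InSubtree (fsuc i)) (PlacedInSubtree (fsuc i)) (fsuc i)) →
      Spans (joinChildren f t is acc) (ChildVertex t is) (ChildEdge t is) t
    joinChildren-spans f t [] acc _ S-acc _ =
      Spans-resp S-acc (λ _ → inj₁) (λ _ → [ (λ x∈ → x∈) , (λ { (_ , () , _) }) ]) (λ _ ()) (λ { _ (_ , () , _) })
    joinChildren-spans f t (i ∷ is) acc (i∉is ∷ uniq) S-acc S-child with parent T i Fin.≟ t
    ... | yes i→t = Spans-resp (join-spans S₁ S₂ shared disjoint) widen₁ narrow₁ widenE narrowE
      where
      s : Node T
      s = fsuc i
      S₁ : Spans (toParent i i→t (subtreeTerm f s)) (λ x → InSubtree s x ⊎ x ∈ℕ bag D t) (PlacedInSubtree s) t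
      S₁ = toParent-spans i i→t (subtreeTerm f s) (S-child i (here refl) i→t)
      S₂ : Spans (joinChildren f t is acc) (ChildVertex t is) (ChildEdge t is) t
      S₂ = joinChildren-spans f t is acc uniq S-acc (λ j j∈ → S-child j (there j∈))
      i≢ : ∀ {j} → j ∈ is → i ≢ j
      i≢ j∈ = All.lookup i∉is j∈
      shared : ∀ x → (InSubtree s x ⊎ x ∈ℕ bag D t) → ChildVertex t is x → x ∈ℕ bag D t
      shared x (inj₂ x∈t) _ = x∈t
      shared x (inj₁ _) (inj₁ x∈t) = x∈t
      shared x (inj₁ (y₁ , s≼y₁ , x∈y₁)) (inj₂ (j , j∈ , j→t , (y₂ , j≼y₂ , x∈y₂))) =
        let s⋠y₂ : ¬ (s ≼ y₂)
            s⋠y₂ s≼y₂ = i≢ j∈ (child-unique i j i→t j→t s≼y₂ j≼y₂)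
        in subst (λ z → x ∈ℕ bag D z) i→t (proj₂ (PathIn-leaves-subtree i (connected D x y₁ y₂ x∈y₁ x∈y₂) s≼y₁ s⋠y₂))
      disjoint : ∀ e → PlacedInSubtree s e → ChildEdge t is e → ⊥
      disjoint e (p₁ , p₁∈ , e≡₁ , s≼) (j , j∈ , j→t , (p₂ , p₂∈ , e≡₂ , j≼)) with edge-injective placements-unique p₁∈ p₂∈ (trans e≡₁ (sym e≡₂))
      ... | refl = i≢ j∈ (child-unique i j i→t j→t s≼ j≼)
      widen₁ : ∀ x → (InSubtree s x ⊎ x ∈ℕ bag D t) ⊎ ChildVertex t is x → ChildVertex t (i ∷ is) x
      widen₁ x (inj₁ (inj₁ below)) = inj₂ (i , here refl , i→t , below)
      widen₁ x (inj₁ (inj₂ x∈t)) = inj₁ x∈t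
      widen₁ x (inj₂ (inj₁ x∈t)) = inj₁ x∈t
      widen₁ x (inj₂ (inj₂ (j , j∈ , j→t , below))) = inj₂ (j , there j∈ , j→t , below)
      narrow₁ : ∀ x → ChildVertex t (i ∷ is) x → (InSubtree s x ⊎ x ∈ℕ bag D t) ⊎ ChildVertex t is x
      narrow₁ x (inj₁ x∈t) = inj₁ (inj₂ x∈t)
      narrow₁ x (inj₂ (j , here refl , _ , below)) = inj₁ (inj₁ below)
      narrow₁ x (inj₂ (j , there j∈ , j→t , below)) = inj₂ (inj₂ (j , j∈ , j→t , below))
      widenE : ∀ e → PlacedInSubtree s e ⊎ ChildEdge t is e → ChildEdge t (i ∷ is) e
      widenE e (inj₁ placed) = i , here refl , i→t , placed
      widenE e (inj₂ (j , j∈ , j→t , placed)) = j , there j∈ , j→t , placed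
      narrowE : ∀ e → ChildEdge t (i ∷ is) e → PlacedInSubtree s e ⊎ ChildEdge t is e
      narrowE e (j , here refl , _ , placed) = inj₁ placed
      narrowE e (j , there j∈ , j→t , placed) = inj₂ (j , j∈ , j→t , placed)
    ... | no i↛t = Spans-resp (joinChildren-spans f t is acc uniq S-acc (λ j j∈ → S-child j (there j∈))) widen narrow widenE narrowE
      where
      widen : ∀ x → ChildVertex t is x → ChildVertex t (i ∷ is) x
      widen x (inj₁ x∈t) = inj₁ x∈t
      widen x (inj₂ (j , j∈ , j→t , below)) = inj₂ (j , there j∈ , j→t , below)
      narrow : ∀ x → ChildVertex t (i ∷ is) x → ChildVertex t is x
      narrow x (inj₁ x∈t) = inj₁ x∈t
      narrow x (inj₂ (j , here refl , j→t , _)) = ⊥-elim (i↛t j→t)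
      narrow x (inj₂ (j , there j∈ , j→t , below)) = inj₂ (j , j∈ , j→t , below)
      widenE : ∀ e → ChildEdge t is e → ChildEdge t (i ∷ is) e
      widenE e (j , j∈ , j→t , placed) = j , there j∈ , j→t , placed
      narrowE : ∀ e → ChildEdge t (i ∷ is) e → ChildEdge t is e
      narrowE e (j , here refl , j→t , _) = ⊥-elim (i↛t j→t)
      narrowE e (j , there j∈ , j→t , placed) = j , j∈ , j→t , placed

    PlacedAt : Node T → List PlacedEdge → (ℕ → Set) → ℕ → Set
    PlacedAt t ps PE e = PE e ⊎ ∃[ p ] (p ∈ ps × node p ≡ t × edge p ≡ e)

    introduceEdges-spans : ∀ t (ps : List PlacedEdge) (σ : ITD k (bagLabels t)) {PV PE} → Unique (map edge ps) →
      Spans σ PV PE t → (∀ p → p ∈ ps → node p ≡ t → PE (edge p) → ⊥) →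
      Spans (introduceEdges ps t σ) PV (PlacedAt t ps PE) t
    introduceEdges-spans t [] σ _ S _ =
      Spans-resp S (λ _ px → px) (λ _ px → px) (λ _ → inj₁) (λ { _ (inj₁ pe) → pe ; _ (inj₂ (_ , () , _)) })
    introduceEdges-spans t (p ∷ ps) σ {PV} {PE} (p∉ps ∷ uniq) S new with node p Fin.≟ t
    ... | yes refl = record
      { VS = VS ; ES = edge p ∷ ES ; α = α
      ; realises = introEdge realises e∉ ends' (λ _ → refl)
      ; VS⁻ = VS⁻ ; VS⁺ = VS⁺
      ; ES⁻ = λ { e (here refl) → inj₂ (p , here refl , refl , refl) ; e (there e∈) → widen (ES⁻ e e∈) }
      ; ES⁺ = λ { e (inj₁ pe) → there (ES⁺ e (inj₁ pe))
                ; e (inj₂ (q , here refl , _ , e≡)) → here (sym e≡)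
                ; e (inj₂ (q , there q∈ , q→t , e≡)) → there (ES⁺ e (inj₂ (q , q∈ , q→t , e≡))) }
      ; labels-bag = labels-bag }
      where
      open Spans (introduceEdges-spans (node p) ps σ uniq S (λ q q∈ → new q (there q∈)))
      widen : ∀ {e} → PlacedAt (node p) ps PE e → PlacedAt (node p) (p ∷ ps) PE e
      widen (inj₁ pe) = inj₁ pe
      widen (inj₂ (q , q∈ , q→t , e≡)) = inj₂ (q , there q∈ , q→t , e≡)
      e∉ : ¬ (edge p ∈ℕ ES)
      e∉ e∈ with ES⁻ _ e∈
      ... | inj₁ pe = new p (here refl) refl pe
      ... | inj₂ (q , q∈ , _ , e≡) = All.lookup p∉ps (∈-map⁺ edge q∈) (sym e≡)
      ends' : Ends (I G) (edge p) (α (colour (node p) (end₁ p))) (α (colour (node p) (end₂ p)))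
      ends' = subst₂ (Ends (I G) (edge p)) (sym (labels-bag (end₁ p) (end₁∈ p))) (sym (labels-bag (end₂ p) (end₂∈ p))) (ends p)
    ... | no p↛t = Spans-resp (introduceEdges-spans t ps σ uniq S (λ q q∈ → new q (there q∈))) (λ _ px → px) (λ _ px → px) widen narrow
      where
      widen : ∀ e → PlacedAt t ps PE e → PlacedAt t (p ∷ ps) PE e
      widen e (inj₁ pe) = inj₁ pe
      widen e (inj₂ (q , q∈ , q→t , e≡)) = inj₂ (q , there q∈ , q→t , e≡)
      narrow : ∀ e → PlacedAt t (p ∷ ps) PE e → PlacedAt t ps PE e
      narrow e (inj₁ pe) = inj₁ pe
      narrow e (inj₂ (q , here refl , q→t , _)) = ⊥-elim (p↛t q→t)
      narrow e (inj₂ (q , there q∈ , q→t , e≡)) = inj₂ (q , q∈ , q→t , e≡)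

    subtreeTerm-spans : ∀ f t → m T < toℕ t + f → Spans (subtreeTerm f t) (InSubtree t) (PlacedInSubtree t) t
    subtreeTerm-spans zero t t+0>m =
      ⊥-elim (ℕ.<⇒≱ t+0>m (subst (_≤ m T) (sym (ℕ.+-identityʳ (toℕ t))) (ℕ.≤-pred (Fin.toℕ<n t))))
    subtreeTerm-spans (suc f) t t+f>m = Spans-resp S-edges vertices⊆ vertices⊇ edges⊆ edges⊇
      where
      fuel-child : ∀ i → parent T i ≡ t → m T < toℕ (fsuc i) + f
      fuel-child i refl = ℕ.<-≤-trans (subst (m T <_) (ℕ.+-suc (toℕ (parent T i)) f) t+f>m) (s≤s (ℕ.+-monoˡ-≤ f (parent-< T i)))
      S-children : Spans (joinChildren f t (allFin (m T)) (proj₂ (bagTerm t))) (ChildVertex t (allFin (m T))) (ChildEdge t (allFin (m T))) t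
      S-children = joinChildren-spans f t (allFin (m T)) (proj₂ (bagTerm t)) (Unique.allFin⁺ (m T)) (bagTerm-spans t)
                     (λ i _ i→t → subtreeTerm-spans f (fsuc i) (fuel-child i i→t))
      not-yet : ∀ p → p ∈ placements → node p ≡ t → ChildEdge t (allFin (m T)) (edge p) → ⊥
      not-yet p p∈ p→t (i , _ , i→t , (q , q∈ , e≡ , i≼q)) with edge-injective placements-unique q∈ p∈ e≡
      ... | refl = parent⋠child i (subst (fsuc i ≼_) (trans p→t (sym i→t)) i≼q)
      S-edges : Spans (subtreeTerm (suc f) t) (ChildVertex t (allFin (m T))) (PlacedAt t placements (ChildEdge t (allFin (m T)))) t
      S-edges = introduceEdges-spans t placements _ placements-unique S-children not-yet
      vertices⊆ : ∀ x → ChildVertex t (allFin (m T)) x → InSubtree t x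
      vertices⊆ x (inj₁ x∈t) = t , ≼-refl , x∈t
      vertices⊆ x (inj₂ (i , _ , i→t , (y , i≼y , x∈y))) = y , ≼-trans (≼-child i i→t) i≼y , x∈y
      vertices⊇ : ∀ x → InSubtree t x → ChildVertex t (allFin (m T)) x
      vertices⊇ x (y , t≼y , x∈y) with ≼-split t≼y
      ... | inj₁ refl = inj₁ x∈y
      ... | inj₂ (i , i→t , i≼y) = inj₂ (i , ∈-allFin i , i→t , (y , i≼y , x∈y))
      edges⊆ : ∀ e → PlacedAt t placements (ChildEdge t (allFin (m T))) e → PlacedInSubtree t e
      edges⊆ e (inj₁ (i , _ , i→t , (p , p∈ , e≡ , i≼p))) = p , p∈ , e≡ , ≼-trans (≼-child i i→t) i≼p
      edges⊆ e (inj₂ (p , p∈ , p→t , e≡)) = p , p∈ , e≡ , subst (t ≼_) (sym p→t) ≼-refl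
      edges⊇ : ∀ e → PlacedInSubtree t e → PlacedAt t placements (ChildEdge t (allFin (m T))) e
      edges⊇ e (p , p∈ , e≡ , t≼p) with ≼-split t≼p
      ... | inj₁ p→t = inj₂ (p , p∈ , p→t , e≡)
      ... | inj₂ (i , i→t , i≼p) = inj₁ (i , ∈-allFin i , i→t , (p , p∈ , e≡ , i≼p))

    decomposition-realisation : ∃[ B ] ∃[ τ ] ∃[ VS ] ∃[ ES ] ∃[ α ] (Realises (I G) {B} τ VS ES α × VS ≐ V G × ES ≐ E G)
    decomposition-realisation = bagLabels fzero , subtreeTerm (suc (m T)) fzero , VS , ES , α , realises , VS≐ , ES≐
      where
      open Spans (subtreeTerm-spans (suc (m T)) fzero ℕ.≤-refl)
      VS≐ : VS ≐ V G
      VS≐ x = (λ x∈ → let (y , _ , x∈y) = VS⁻ x x∈ in bag-sub D y x x∈y) ,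
              (λ x∈ → let (y , x∈y) = cover-vertices D x x∈ in VS⁺ x (y , root≼ y , x∈y))
      ES≐ : ES ≐ E G
      ES≐ e = (λ e∈ → let (p , p∈ , e≡ , _) = ES⁻ e e∈ in subst (_∈ℕ E G) e≡ (placement-edge∈ p∈)) ,
              (λ e∈ → let (p , p∈ , e≡) = placement-exists e e∈ in ES⁺ e (p , p∈ , e≡ , root≼ (node p)))

  realisation⇒≃ : ∀ (G : Graph) {B} {τ : ITD k B} {VS ES α} → Realises (I G) τ VS ES α → VS ≐ V G → ES ≐ E G → graphOf τ ≃ G
  realisation⇒≃ G {τ = τ} r VS≐ ES≐ with graphOf-realises τ
  ... | VS₀ , ES₀ , r₀ , VS₀≐ , ES₀≐ = correspondence⇒≃ (proj₁ (realisations-correspond r₀ r)) VS₀≐ ES₀≐ VS≐ ES≐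

  treewidth⇒instructive : ∀ (G : Graph) → IsGraph G → TreewidthAtMost G k → ∃[ B ] ∃[ τ ] (graphOf {k} {B} τ ≃ G)
  treewidth⇒instructive G isGraph (D , width) with FromDecomposition.decomposition-realisation G isGraph D width
  ... | B , τ , _ , _ , _ , r , VS≐ , ES≐ = B , τ , realisation⇒≃ G r VS≐ ES≐

lemma1 : (G : Graph) → IsGraph G → (k : ℕ) →
    TreewidthAtMost G k ⇔ (∃[ B ] ∃[ τ ] (graphOf {k} {B} τ ≃ G))
lemma1 G isGraph k = mk⇔ (treewidth⇒instructive G isGraph) (λ (_ , τ , iso) → instructive⇒treewidth G isGraph τ iso)
  where open Instructive k
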